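{- Let $d$ be a squarefree positive integer, let $K=\mathbb{Q}(\sqrt{ -d})$, and let $O_K$ be the ring of algebraic integers in $K$. Let $n$ be a positive integer, let $x_1,\ldots,x_n\in O_K$, and set $y=2\prod_{k=1}^n(3x_k+1)$. Then $$y+\sum_{k=1}^n\frac{x_k}{y^k}\in\mathbb{Q}\iff x_1,\ldots,x_n\in\mathbb{Z}.$$ -}

module Defs where

open import Data.Nat as ℕ using (ℕ; zero; suc)
open import Data.Nat.Divisibility using (_∣_)
open import Data.Integer as ℤ using (ℤ)
open import Data.Rational as ℚ using (ℚ; 0ℚ; 1ℚ; _≟_; ≢-nonZero)
open import Data.Fin using (Fin; toℕ) renaming (zero to fzero; suc to fsuc)
open import Data.List using (List; []; _∷_)
open import Data.Product using (Σ; _×_; ∃)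
open import Relation.Binary.PropositionalEquality using (_≡_)
open import Relation.Nullary using (yes; no)

SquareFree : ℕ → Set
SquareFree d = ∀ (m : ℕ) → m ℕ.* m ∣ d → m ≡ 1

-- Elements of K = ℚ(√-d): a + b√-d  (with a, b ∈ ℚ); the representation is unique
record K (d : ℕ) : Set where
  constructor _+_√-d
  field
    re : ℚ
    im : ℚ
open K public

module _ {d : ℕ} where
  dℚ : ℚ
  dℚ = ℤ.+ d ℚ./ 1

  infixl 6 _⊕_
  infixl 7 _⊗_
  _⊕_ : K d → K d → K d
  (a + b √-d) ⊕ (c + e √-d) = (a ℚ.+ c) + (b ℚ.+ e) √-d

  _⊗_ : K d → K d → K d
  (a + b √-d) ⊗ (c + e √-d) =
    (a ℚ.* c ℚ.- dℚ ℚ.* (b ℚ.* e)) + (a ℚ.* e ℚ.+ b ℚ.* c) √-d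

  ι : ℚ → K d
  ι q = q + 0ℚ √-d

  ιℤ : ℤ → K d
  ιℤ z = ι (z ℚ./ 1)

  -- rational inverse, with the (irrelevant) convention 1/0 = 0
  invℚ : ℚ → ℚ
  invℚ q with q ≟ 0ℚ
  ... | yes _ = 0ℚ
  ... | no q≢0 = ℚ.1/_ q {{≢-nonZero q≢0}}

  -- inverse in K: (a + b√-d)⁻¹ = (a - b√-d)/(a² + d b²)  (0⁻¹ = 0 by convention)
  inv : K d → K d
  inv (a + b √-d) =
    let N = invℚ (a ℚ.* a ℚ.+ dℚ ℚ.* (b ℚ.* b)) in
    (a ℚ.* N) + (ℚ.- b ℚ.* N) √-d

  _⊘_ : K d → K d → K d
  x ⊘ y = x ⊗ inv y

  _^ᴷ_ : K d → ℕ → K d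
  x ^ᴷ zero = ι 1ℚ
  x ^ᴷ suc k = x ⊗ (x ^ᴷ k)

  -- Value at α of the monic integer polynomial with lower coefficients
  -- c₀, …, c_{m-1}:  α^m + c_{m-1} α^{m-1} + … + c₀  (Horner form)
  evalMonic : List ℤ → K d → K d
  evalMonic [] α = ι 1ℚ
  evalMonic (c ∷ cs) α = ιℤ c ⊕ α ⊗ evalMonic cs α

  IsAlgInt : K d → Set
  IsAlgInt α = Σ (List ℤ) λ cs → evalMonic cs α ≡ ι 0ℚ

  InQ : K d → Set
  InQ x = im x ≡ 0ℚ

  InZ : K d → Set
  InZ x = Σ ℤ λ z → x ≡ ιℤ z

  -- finite product ∏_{k=1}^n f k, indices as Fin n (k = toℕ i + 1)
  prodK : (n : ℕ) → (Fin n → K d) → K d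
  prodK zero f = ι 1ℚ
  prodK (suc n) f = f fzero ⊗ prodK n (λ i → f (fsuc i))

  sumK : (n : ℕ) → (Fin n → K d) → K d
  sumK zero f = ι 0ℚ
  sumK (suc n) f = f fzero ⊕ sumK n (λ i → f (fsuc i))

module Submission where

-- An element of K is an algebraic integer iff its trace and norm are integers: an algebraic
-- integer has a common denominator for all its powers, and a rational with that property is an
-- integer; as d is squarefree, 2·im x is then an integer as well. Each factor u = 3x + 1 has
-- integral norm N(u) = 3(3N(x) + Tr(x)) + 1 ≥ 0, hence N(u) ≥ 1, so N(y) ≥ 4 and
-- 9·N(x_k) ≤ 4·N(u_k) ≤ N(y). If im y ≠ 0 then |im y| ≥ 1 (as y = 2·∏ u_k), whereas
-- |im(x_k / y^k)| ≤ (1/3)(1/2)^(k-1), so the sum cannot cancel im y. If im y = 0 then y = Y ∈ ℤ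
-- and Σ 2·im(x_k)·Y^(-k) = 0 is an expansion in base |Y| with integer digits |2·im x_k| < |Y|,
-- so every im x_k vanishes, and an algebraic integer in ℚ lies in ℤ.

open import Defs
open import Data.Nat using (ℕ; zero; suc; _>_)
open import Data.Integer using (+_)
open import Data.Rational using (_/_)
open import Data.Fin using (Fin; toℕ)
open import Function.Bundles using (_⇔_; mk⇔)

open import Level using (0ℓ)
open import Data.Product using (Σ; _,_; _×_; proj₁; proj₂)
open import Data.Sum using (inj₁; inj₂)
open import Data.Fin using () renaming (zero to fzero; suc to fsuc)
open import Data.List using ([]; _∷_; length)
import Data.Maybe as Maybe
import Data.Nat as ℕ
import Data.Nat.Properties as ℕP
open import Data.Nat.Induction using (<-rec)
open import Data.Nat.Divisibility using (_∣_; divides; ∣-trans; *-monoˡ-∣; *-cancelˡ-∣; ∣⇒≤)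
open import Data.Nat.Coprimality using (Coprime; coprime-divisor; 1-coprimeTo; recompute)
  renaming (sym to coprime-sym)
open import Data.Integer as ℤ using (ℤ; -[1+_])
import Data.Integer.Properties as ℤP
open import Data.Rational
  using ( ℚ; mkℚ; 0ℚ; 1ℚ; ½; ↥_; ↧_; ↧ₙ_; _+_; _*_; _-_; -_; ∣_∣; _≤_; _<_; *≤*; *<*
        ; toℚᵘ; Positive; nonNegative; positive; 1/_; ≢-nonZero)
import Data.Rational.Properties as ℚP
import Data.Rational.Unnormalised as ℚᵘ
import Data.Rational.Unnormalised.Properties as ℚᵘP
open import Data.Rational.Solver using (module +-*-Solver)
open +-*-Solver using (solve; _:+_; _:*_; _:-_; :-_; con; _:=_)
open import Algebra.Bundles using (CommutativeRing)
open import Algebra.Definitions.RawSemiring Data.Rational.+-*-rawSemiring using (_^_; sum; product)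
open import Algebra.Properties.CommutativeSemiring.Exp
  (CommutativeRing.commutativeSemiring ℚP.+-*-commutativeRing) using (^-distrib-*)
open import Algebra.Properties.Group ℚP.+-0-group using (inverseˡ-unique; inverseʳ-unique)
open import Algebra.Properties.Monoid.Sum ℚP.+-0-monoid using (sum-cong-≗)
open import Algebra.Properties.Semiring.Sum (CommutativeRing.semiring ℚP.+-*-commutativeRing)
  using (*-distribˡ-sum)
import Algebra.Solver.Ring as RingSolver
open import Algebra.Solver.Ring.AlmostCommutativeRing
  using (_-Raw-AlmostCommutative⟶_; fromCommutativeRing)
open import Relation.Binary.PropositionalEquality
open import Relation.Binary.Definitions using (tri<; tri≈; tri>)
open import Relation.Nullary using (¬_; Dec; yes; no; contradiction)
open import Relation.Nullary.Decidable using (toWitness; dec⇒maybe)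

-- Integers inside ℚ

/1≡mkℚ : ∀ z → z / 1 ≡ mkℚ z 0 (coprime-sym (1-coprimeTo _))
/1≡mkℚ z = ℚP.↥p/↧p≡p (mkℚ z 0 (coprime-sym (1-coprimeTo _)))

/1-homo-+ : ∀ a b → (a ℤ.+ b) / 1 ≡ a / 1 + b / 1
/1-homo-+ a b rewrite /1≡mkℚ a | /1≡mkℚ b =
  sym (cong (_/ 1) (cong₂ ℤ._+_ (ℤP.*-identityʳ a) (ℤP.*-identityʳ b)))

/1-homo-* : ∀ a b → (a ℤ.* b) / 1 ≡ a / 1 * (b / 1)
/1-homo-* a b rewrite /1≡mkℚ a | /1≡mkℚ b = refl

/1-homo-neg : ∀ a → (ℤ.- a) / 1 ≡ - (a / 1)
/1-homo-neg (+ 0) = refl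
/1-homo-neg (+ suc n) rewrite /1≡mkℚ (+ suc n) = refl
/1-homo-neg -[1+ n ] rewrite /1≡mkℚ (+ suc n) = refl

/1-injective : ∀ {a b} → a / 1 ≡ b / 1 → a ≡ b
/1-injective {a} {b} eq rewrite /1≡mkℚ a | /1≡mkℚ b = cong ↥_ eq

/1-mono-≤ : ∀ {a b} → a ℤ.≤ b → a / 1 ≤ b / 1
/1-mono-≤ {a} {b} a≤b rewrite /1≡mkℚ a | /1≡mkℚ b =
  *≤* (subst₂ ℤ._≤_ (sym (ℤP.*-identityʳ a)) (sym (ℤP.*-identityʳ b)) a≤b)

/1-cancel-< : ∀ {a b} → a / 1 < b / 1 → a ℤ.< b
/1-cancel-< {a} {b} lt rewrite /1≡mkℚ a | /1≡mkℚ b with lt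
... | *<* a<b = subst₂ ℤ._<_ (ℤP.*-identityʳ a) (ℤP.*-identityʳ b) a<b

+/1-homo-* : ∀ m n → + (m ℕ.* n) / 1 ≡ + m / 1 * (+ n / 1)
+/1-homo-* m n = trans (cong (_/ 1) (ℤP.pos-* m n)) (/1-homo-* (+ m) (+ n))

+/1-homo-^ : ∀ m k → + (m ℕ.^ k) / 1 ≡ (+ m / 1) ^ k
+/1-homo-^ m zero = refl
+/1-homo-^ m (suc k) = trans (+/1-homo-* m (m ℕ.^ k)) (cong (+ m / 1 *_) (+/1-homo-^ m k))

*-denominator : ∀ q → q * (↧ q / 1) ≡ ↥ q / 1
*-denominator q@(mkℚ n d _) =
  ℚP.toℚᵘ-injective (ℚᵘP.≃-trans (ℚP.toℚᵘ-homo-* q (↧ q / 1)) cross)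
  where
  cross : toℚᵘ q ℚᵘ.* toℚᵘ (↧ q / 1) ℚᵘ.≃ toℚᵘ (↥ q / 1)
  cross rewrite /1≡mkℚ (↧ q) | /1≡mkℚ (↥ q) =
    ℚᵘ.*≡* (trans (ℤP.*-identityʳ _) (cong (λ k → n ℤ.* + suc k) (sym (ℕP.*-identityʳ d))))

IsInteger : ℚ → Set
IsInteger q = Σ ℤ λ z → q ≡ z / 1

IsInteger-+ : ∀ {p q} → IsInteger p → IsInteger q → IsInteger (p + q)
IsInteger-+ (a , refl) (b , refl) = a ℤ.+ b , sym (/1-homo-+ a b)

IsInteger-* : ∀ {p q} → IsInteger p → IsInteger q → IsInteger (p * q)
IsInteger-* (a , refl) (b , refl) = a ℤ.* b , sym (/1-homo-* a b)

IsInteger-neg : ∀ {p} → IsInteger p → IsInteger (- p)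
IsInteger-neg (a , refl) = ℤ.- a , sym (/1-homo-neg a)

IsInteger-∣∣ : ∀ {p} → IsInteger p → IsInteger ∣ p ∣
IsInteger-∣∣ (a , refl) rewrite /1≡mkℚ a = + ℤ.∣ a ∣ , sym (/1≡mkℚ (+ ℤ.∣ a ∣))

IsInteger-^ : ∀ {p} k → IsInteger p → IsInteger (p ^ k)
IsInteger-^ zero _ = + 1 , refl
IsInteger-^ (suc k) p∈ℤ = IsInteger-* p∈ℤ (IsInteger-^ k p∈ℤ)

↧ₙ≡1⇒IsInteger : ∀ q → ↧ₙ q ≡ 1 → IsInteger q
↧ₙ≡1⇒IsInteger (mkℚ n zero _) _ = n , sym (/1≡mkℚ n)

IsInteger⇒∣ : ∀ {p} s m → IsInteger p → p * (+ s / 1) ≡ m / 1 → s ∣ ℤ.∣ m ∣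
IsInteger⇒∣ s m (z , refl) eq =
  divides ℤ.∣ z ∣ (trans (cong ℤ.∣_∣ (sym z*s≡m)) (ℤP.abs-* z (+ s)))
  where
  z*s≡m : z ℤ.* + s ≡ m
  z*s≡m = /1-injective (trans (/1-homo-* z (+ s)) eq)

-- Two integrality criteria

coprime-∣^* : ∀ {s a} → Coprime s a → ∀ k c → s ∣ a ℕ.^ k ℕ.* c → s ∣ c
coprime-∣^* _ zero c s∣c = subst (_ ∣_) (ℕP.+-identityʳ c) s∣c
coprime-∣^* {s} {a} s⊥a (suc k) c s∣aᵏ⁺¹c = coprime-∣^* s⊥a k c
  (coprime-divisor s⊥a (subst (s ∣_) (ℕP.*-assoc a (a ℕ.^ k) c) s∣aᵏ⁺¹c))

n<2^n : ∀ n → n ℕ.< 2 ℕ.^ n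
n<2^n zero = ℕ.s≤s ℕ.z≤n
n<2^n (suc n) = ℕP.+-mono-≤-< (ℕP.m^n>0 2 n) (ℕP.<-≤-trans (n<2^n n) (ℕP.m≤m+n _ 0))

∣^∣ : ∀ p k → ∣ p ^ k ∣ ≡ ∣ p ∣ ^ k
∣^∣ p zero = refl
∣^∣ p (suc k) = trans (ℚP.∣p*q∣≡∣p∣*∣q∣ p (p ^ k)) (cong (∣ p ∣ *_) (∣^∣ p k))

-- If E·t^k ∈ ℤ for all k and t = r/s in lowest terms, then s^k ∣ E for all k: from E = m·s^k,
-- (E·t^(k+1))·s = m·r^(k+1), so s ∣ m·r^(k+1) and s ∣ m by coprimality.
denominator^-∣ : ∀ E r d .(r⊥s : Coprime r (suc d)) →
  (∀ k → IsInteger (+ E / 1 * mkℚ (+ r) d r⊥s ^ k)) → ∀ k → suc d ℕ.^ k ∣ E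
denominator^-∣ E r d r⊥s integral zero = divides E (sym (ℕP.*-identityʳ E))
denominator^-∣ E r d r⊥s integral (suc k) with denominator^-∣ E r d r⊥s integral k
... | divides m refl = *-monoˡ-∣ (suc d ℕ.^ k) s∣m
  where
  open ≡-Reasoning
  t S R M : ℚ
  t = mkℚ (+ r) d r⊥s
  S = + suc d / 1
  R = + r / 1
  M = + m / 1
  St≡R : S * t ≡ R
  St≡R = trans (ℚP.*-comm S t) (*-denominator t)
  scaled : + (m ℕ.* suc d ℕ.^ k) / 1 * t ^ suc k * S ≡ + (r ℕ.^ suc k ℕ.* m) / 1
  scaled = begin
    + (m ℕ.* suc d ℕ.^ k) / 1 * t ^ suc k * S
      ≡⟨ cong (λ e → e * t ^ suc k * S)
              (trans (+/1-homo-* m _) (cong (M *_) (+/1-homo-^ (suc d) k))) ⟩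
    M * S ^ k * (t * t ^ k) * S
      ≡⟨ solve 5 (λ M P t Q S → M :* P :* (t :* Q) :* S := M :* (S :* t) :* (P :* Q))
               refl M (S ^ k) t (t ^ k) S ⟩
    M * (S * t) * (S ^ k * t ^ k)
      ≡⟨ cong₂ (λ a b → M * a * b) St≡R (trans (sym (^-distrib-* S t k)) (cong (_^ k) St≡R)) ⟩
    M * R * R ^ k
      ≡⟨ solve 3 (λ M R Q → M :* R :* Q := R :* Q :* M) refl M R (R ^ k) ⟩
    R ^ suc k * M
      ≡⟨ sym (trans (+/1-homo-* (r ℕ.^ suc k) m) (cong (_* M) (+/1-homo-^ r (suc k)))) ⟩
    + (r ℕ.^ suc k ℕ.* m) / 1 ∎
  s∣m : suc d ∣ m
  s∣m = coprime-∣^* (coprime-sym (recompute r⊥s)) (suc k) m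
          (IsInteger⇒∣ (suc d) (+ (r ℕ.^ suc k ℕ.* m)) (integral (suc k)) scaled)

IsInteger-of-bounded-powers : ∀ {E} → E ≢ 0 → ∀ t →
  (∀ k → IsInteger (+ E / 1 * t ^ k)) → IsInteger t
IsInteger-of-bounded-powers _ t@(mkℚ _ zero _) _ = ↧ₙ≡1⇒IsInteger t refl
IsInteger-of-bounded-powers {E} E≢0 t@(mkℚ n (suc d) c) integral = contradiction
  (ℕP.<-≤-trans (n<2^n E) (ℕP.≤-trans (ℕP.^-monoˡ-≤ E (ℕ.s≤s (ℕ.s≤s ℕ.z≤n))) s^E≤E))
  (ℕP.<-irrefl refl)
  where
  ∣t∣-integral : ∀ k → IsInteger (+ E / 1 * ∣ t ∣ ^ k)
  ∣t∣-integral k = subst IsInteger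
    (trans (ℚP.∣p*q∣≡∣p∣*∣q∣ (+ E / 1) (t ^ k))
      (cong₂ _*_ (trans (cong ∣_∣ (/1≡mkℚ (+ E))) (sym (/1≡mkℚ (+ E)))) (∣^∣ t k)))
    (IsInteger-∣∣ (integral k))
  s^E≤E : suc (suc d) ℕ.^ E ℕ.≤ E
  s^E≤E = ∣⇒≤ {{ℕ.≢-nonZero E≢0}} (denominator^-∣ E ℤ.∣ n ∣ (suc d) c ∣t∣-integral E)

coprime-square-∣ : ∀ D r s .{{_ : ℕ.NonZero s}} →
  Coprime s r → s ℕ.* s ∣ D ℕ.* (r ℕ.* r) → s ℕ.* s ∣ D
coprime-square-∣ D r s s⊥r s²∣Dr²
  with coprime-∣^* s⊥r 2 D (subst (s ∣_) Dr²≡r²D (∣-trans (divides s refl) s²∣Dr²))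
  where
  Dr²≡r²D : D ℕ.* (r ℕ.* r) ≡ r ℕ.^ 2 ℕ.* D
  Dr²≡r²D = trans (ℕP.*-comm D (r ℕ.* r)) (cong (λ e → r ℕ.* e ℕ.* D) (sym (ℕP.*-identityʳ r)))
... | divides D′ refl = *-monoˡ-∣ s s∣D′
  where
  regroup : D′ ℕ.* s ℕ.* (r ℕ.* r) ≡ s ℕ.* (r ℕ.^ 2 ℕ.* D′)
  regroup = trans (cong (ℕ._* (r ℕ.* r)) (ℕP.*-comm D′ s))
    (trans (ℕP.*-assoc s D′ (r ℕ.* r))
      (cong (s ℕ.*_) (trans (ℕP.*-comm D′ (r ℕ.* r))
        (cong (λ e → r ℕ.* e ℕ.* D′) (sym (ℕP.*-identityʳ r))))))
  s∣D′ : s ∣ D′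
  s∣D′ = coprime-∣^* s⊥r 2 D′ (*-cancelˡ-∣ s (subst (s ℕ.* s ∣_) regroup s²∣Dr²))

IsInteger-of-squarefree-multiple : ∀ {D} → SquareFree D → ∀ q →
  IsInteger (+ D / 1 * (q * q)) → IsInteger q
IsInteger-of-squarefree-multiple {D} squarefree q@(mkℚ n d c) integral = ↧ₙ≡1⇒IsInteger q
  (squarefree (suc d) (coprime-square-∣ D ℤ.∣ n ∣ (suc d) (coprime-sym (recompute c)) s²∣Dr²))
  where
  open ≡-Reasoning
  S : ℚ
  S = + suc d / 1
  scaled : + D / 1 * (q * q) * (+ (suc d ℕ.* suc d) / 1) ≡ (+ D ℤ.* (n ℤ.* n)) / 1
  scaled = begin
    + D / 1 * (q * q) * (+ (suc d ℕ.* suc d) / 1)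
      ≡⟨ cong (+ D / 1 * (q * q) *_) (+/1-homo-* (suc d) (suc d)) ⟩
    + D / 1 * (q * q) * (S * S)
      ≡⟨ solve 3 (λ a q S → a :* (q :* q) :* (S :* S) := a :* ((q :* S) :* (q :* S)))
               refl (+ D / 1) q S ⟩
    + D / 1 * ((q * S) * (q * S))
      ≡⟨ cong (λ e → + D / 1 * (e * e)) (*-denominator q) ⟩
    + D / 1 * (n / 1 * (n / 1))
      ≡⟨ cong (+ D / 1 *_) (sym (/1-homo-* n n)) ⟩
    + D / 1 * ((n ℤ.* n) / 1)
      ≡⟨ sym (/1-homo-* (+ D) (n ℤ.* n)) ⟩
    (+ D ℤ.* (n ℤ.* n)) / 1 ∎
  s²∣Dr² : suc d ℕ.* suc d ∣ D ℕ.* (ℤ.∣ n ∣ ℕ.* ℤ.∣ n ∣)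
  s²∣Dr² = subst (suc d ℕ.* suc d ∣_) (trans (ℤP.abs-* (+ D) (n ℤ.* n)) (cong (D ℕ.*_) (ℤP.abs-* n n)))
             (IsInteger⇒∣ (suc d ℕ.* suc d) (+ D ℤ.* (n ℤ.* n)) integral scaled)

-- Order facts in ℚ

<⇒≱ : ∀ {p q} → p < q → ¬ q ≤ p
<⇒≱ p<q q≤p = ℚP.<-irrefl refl (ℚP.<-≤-trans p<q q≤p)

0≤q-p : ∀ {p q} → p ≤ q → 0ℚ ≤ q - p
0≤q-p {p} {q} p≤q = subst (_≤ q - p) (ℚP.+-inverseʳ p) (ℚP.+-monoˡ-≤ (- p) p≤q)

0≤1 : 0ℚ ≤ 1ℚ
0≤1 = ℚP.<⇒≤ (ℚP.positive⁻¹ 1ℚ)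

0≤* : ∀ {p q} → 0ℚ ≤ p → 0ℚ ≤ q → 0ℚ ≤ p * q
0≤* {p} {q} 0≤p 0≤q =
  subst (_≤ p * q) (ℚP.*-zeroˡ q) (ℚP.*-monoʳ-≤-nonNeg q {{nonNegative 0≤q}} 0≤p)

*-mono-≤-nonNeg : ∀ {p q r s} → 0ℚ ≤ p → 0ℚ ≤ r → p ≤ q → r ≤ s → p * r ≤ q * s
*-mono-≤-nonNeg {p} {q} {r} {s} 0≤p 0≤r p≤q r≤s =
  ℚP.≤-trans (ℚP.*-monoʳ-≤-nonNeg r {{nonNegative 0≤r}} p≤q)
             (ℚP.*-monoˡ-≤-nonNeg q {{nonNegative (ℚP.≤-trans 0≤p p≤q)}} r≤s)

∣p∣*∣p∣≡p*p : ∀ p → ∣ p ∣ * ∣ p ∣ ≡ p * p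
∣p∣*∣p∣≡p*p p with ℚP.∣p∣≡p∨∣p∣≡-p p
... | inj₁ ∣p∣≡p = cong (λ e → e * e) ∣p∣≡p
... | inj₂ ∣p∣≡-p =
  trans (cong (λ e → e * e) ∣p∣≡-p) (solve 1 (λ p → :- p :* :- p := p :* p) refl p)

0≤p*p : ∀ p → 0ℚ ≤ p * p
0≤p*p p = subst (0ℚ ≤_) (∣p∣*∣p∣≡p*p p) (0≤* (ℚP.0≤∣p∣ p) (ℚP.0≤∣p∣ p))

p≢0⇒0<∣p∣ : ∀ {p} → p ≢ 0ℚ → 0ℚ < ∣ p ∣
p≢0⇒0<∣p∣ {p} p≢0 with ℚP.<-cmp 0ℚ ∣ p ∣
... | tri< 0<∣p∣ _ _ = 0<∣p∣
... | tri≈ _ 0≡∣p∣ _ = contradiction (ℚP.∣p∣≡0⇒p≡0 p (sym 0≡∣p∣)) p≢0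
... | tri> _ _ ∣p∣<0 = contradiction (ℚP.0≤∣p∣ p) (<⇒≱ ∣p∣<0)

p*p≤r*r⇒∣p∣≤r : ∀ p r → 0ℚ ≤ r → p * p ≤ r * r → ∣ p ∣ ≤ r
p*p≤r*r⇒∣p∣≤r p r 0≤r p²≤r² = ℚP.≮⇒≥ λ r<∣p∣ → <⇒≱ (r²<p² r<∣p∣)
  (subst (_≤ r * r) (sym (∣p∣*∣p∣≡p*p p)) p²≤r²)
  where
  r²<p² : r < ∣ p ∣ → r * r < ∣ p ∣ * ∣ p ∣
  r²<p² r<∣p∣ = ℚP.≤-<-trans (ℚP.*-monoˡ-≤-nonNeg r {{nonNegative 0≤r}} (ℚP.<⇒≤ r<∣p∣))
    (ℚP.*-monoˡ-<-pos ∣ p ∣ {{positive (ℚP.≤-<-trans 0≤r r<∣p∣)}} r<∣p∣)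

p*p<q*q⇒∣p∣<∣q∣ : ∀ p q → p * p < q * q → ∣ p ∣ < ∣ q ∣
p*p<q*q⇒∣p∣<∣q∣ p q p²<q² = ℚP.≰⇒> λ ∣q∣≤∣p∣ → <⇒≱ p²<q²
  (subst₂ _≤_ (∣p∣*∣p∣≡p*p q) (∣p∣*∣p∣≡p*p p)
    (*-mono-≤-nonNeg (ℚP.0≤∣p∣ q) (ℚP.0≤∣p∣ q) ∣q∣≤∣p∣ ∣q∣≤∣p∣))

IsInteger-0<⇒1≤ : ∀ {p} → IsInteger p → 0ℚ < p → 1ℚ ≤ p
IsInteger-0<⇒1≤ (z , refl) 0<z with /1-cancel-< {+ 0} {z} 0<z
... | ℤ.+<+ {n = suc m} _ = /1-mono-≤ {+ 1} {+ suc m} (ℤ.+≤+ (ℕ.s≤s ℕ.z≤n))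

IsInteger-≢0⇒1≤∣∣ : ∀ {p} → IsInteger p → p ≢ 0ℚ → 1ℚ ≤ ∣ p ∣
IsInteger-≢0⇒1≤∣∣ p∈ℤ p≢0 = IsInteger-0<⇒1≤ (IsInteger-∣∣ p∈ℤ) (p≢0⇒0<∣p∣ p≢0)

IsInteger-∣∣<1⇒≡0 : ∀ {p} → IsInteger p → ∣ p ∣ < 1ℚ → p ≡ 0ℚ
IsInteger-∣∣<1⇒≡0 {p} p∈ℤ ∣p∣<1 with p ℚP.≟ 0ℚ
... | yes p≡0 = p≡0
... | no p≢0 = contradiction (IsInteger-≢0⇒1≤∣∣ p∈ℤ p≢0) (<⇒≱ ∣p∣<1)

IsInteger-<⇒+1≤ : ∀ {p q} → IsInteger p → IsInteger q → p < q → p + 1ℚ ≤ q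
IsInteger-<⇒+1≤ {p} {q} p∈ℤ q∈ℤ p<q =
  subst (p + 1ℚ ≤_) (solve 2 (λ p q → p :+ (q :- p) := q) refl p q)
    (ℚP.+-monoʳ-≤ p (IsInteger-0<⇒1≤ (IsInteger-+ q∈ℤ (IsInteger-neg p∈ℤ))
      (subst (_< q - p) (ℚP.+-inverseʳ p) (ℚP.+-monoˡ-< (- p) p<q))))

0≤^ : ∀ {p} k → 0ℚ ≤ p → 0ℚ ≤ p ^ k
0≤^ zero _ = 0≤1
0≤^ (suc k) 0≤p = 0≤* 0≤p (0≤^ k 0≤p)

0<^ : ∀ {p} k → 0ℚ < p → 0ℚ < p ^ k
0<^ zero _ = ℚP.positive⁻¹ 1ℚ
0<^ {p} (suc k) 0<p = ℚP.positive⁻¹ (p * p ^ k)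
  {{ℚP.pos*pos⇒pos p {{positive 0<p}} (p ^ k) {{positive (0<^ k 0<p)}}}}

^-mono-≤ : ∀ {p q} k → 0ℚ ≤ p → p ≤ q → p ^ k ≤ q ^ k
^-mono-≤ zero _ _ = ℚP.≤-refl
^-mono-≤ (suc k) 0≤p p≤q = *-mono-≤-nonNeg 0≤p (0≤^ k 0≤p) p≤q (^-mono-≤ k 0≤p p≤q)

1≤product : ∀ {n} (g : Fin n → ℚ) → (∀ i → 1ℚ ≤ g i) → 1ℚ ≤ product g
1≤product {zero} _ _ = ℚP.≤-refl
1≤product {suc n} g 1≤g =
  *-mono-≤-nonNeg 0≤1 0≤1 (1≤g fzero) (1≤product (λ i → g (fsuc i)) (λ i → 1≤g (fsuc i)))

≤product : ∀ {n} (g : Fin n → ℚ) → (∀ i → 1ℚ ≤ g i) → ∀ i → g i ≤ product g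
≤product g 1≤g fzero = subst (_≤ product g) (ℚP.*-identityʳ (g fzero))
  (ℚP.*-monoˡ-≤-nonNeg (g fzero) {{nonNegative (ℚP.≤-trans 0≤1 (1≤g fzero))}}
    (1≤product (λ i → g (fsuc i)) (λ i → 1≤g (fsuc i))))
≤product g 1≤g (fsuc i) = ℚP.≤-trans (≤product (λ i → g (fsuc i)) (λ i → 1≤g (fsuc i)) i)
  (subst (_≤ product g) (ℚP.*-identityˡ _)
    (ℚP.*-monoʳ-≤-nonNeg (product (λ i → g (fsuc i)))
      {{nonNegative (ℚP.≤-trans 0≤1 (1≤product (λ i → g (fsuc i)) (λ i → 1≤g (fsuc i))))}}
      (1≤g fzero)))

U-2A+1≤4U : ∀ {U A} → A * A ≤ U → 1ℚ ≤ U → U - (A + A) + 1ℚ ≤ + 4 / 1 * U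
U-2A+1≤4U {U} {A} A²≤U 1≤U = subst₂ _≤_ (ℚP.+-identityʳ _) (sym (split U A))
  (ℚP.+-monoʳ-≤ (U - (A + A) + 1ℚ)
    (ℚP.+-mono-≤ (ℚP.+-mono-≤ (0≤q-p A²≤U) (0≤p*p (A + 1ℚ)))
                 (ℚP.+-mono-≤ (0≤q-p 1≤U) (0≤q-p 1≤U))))
  where
  split : ∀ U A → + 4 / 1 * U
    ≡ (U - (A + A) + 1ℚ) + (((U - A * A) + (A + 1ℚ) * (A + 1ℚ)) + ((U - 1ℚ) + (U - 1ℚ)))
  split = solve 2 (λ U A → con (+ 4 / 1) :* U
    := (U :- (A :+ A) :+ con 1ℚ)
       :+ (((U :- A :* A) :+ (A :+ con 1ℚ) :* (A :+ con 1ℚ)) :+ ((U :- con 1ℚ) :+ (U :- con 1ℚ))))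
    refl

∣sum∣<c+c : ∀ {n} (g : Fin n → ℚ) c → 0ℚ < c →
  (∀ i → ∣ g i ∣ ≤ c * ½ ^ toℕ i) → ∣ sum g ∣ < c + c
∣sum∣<c+c {zero} _ _ 0<c _ = ℚP.+-mono-< 0<c 0<c
∣sum∣<c+c {suc n} g c 0<c ∣g∣≤ =
  ℚP.≤-<-trans (ℚP.∣p+q∣≤∣p∣+∣q∣ (g fzero) (sum (λ i → g (fsuc i))))
    (ℚP.+-mono-≤-< (subst (∣ g fzero ∣ ≤_) (ℚP.*-identityʳ c) (∣g∣≤ fzero))
      (subst (∣ sum (λ i → g (fsuc i)) ∣ <_) (solve 1 (λ c → c :* con ½ :+ c :* con ½ := c) refl c)
        (∣sum∣<c+c (λ i → g (fsuc i)) (c * ½) 0<c½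
          (λ i → subst (∣ g (fsuc i) ∣ ≤_) (sym (ℚP.*-assoc c ½ (½ ^ toℕ i))) (∣g∣≤ (fsuc i))))))
  where
  0<c½ : 0ℚ < c * ½
  0<c½ = ℚP.positive⁻¹ (c * ½) {{ℚP.pos*pos⇒pos c {{positive 0<c}} ½}}

-- Expansions in powers of h

expansion : ∀ {n} → ℚ → (Fin n → ℚ) → ℚ
expansion h g = sum (λ i → g i * h ^ suc (toℕ i))

expansion-suc : ∀ {n} h (g : Fin (suc n) → ℚ) →
  expansion h g ≡ h * (g fzero + expansion h (λ i → g (fsuc i)))
expansion-suc h g = begin
  g fzero * (h * 1ℚ) + sum (λ i → g (fsuc i) * (h * h ^ suc (toℕ i)))
    ≡⟨ cong (λ e → g fzero * (h * 1ℚ) + e) (sum-cong-≗ λ i →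
         solve 3 (λ a h p → a :* (h :* p) := h :* (a :* p)) refl (g (fsuc i)) h (h ^ suc (toℕ i))) ⟩
  g fzero * (h * 1ℚ) + sum (λ i → h * (g (fsuc i) * h ^ suc (toℕ i)))
    ≡⟨ cong (λ e → g fzero * (h * 1ℚ) + e)
            (sym (*-distribˡ-sum h (λ i → g (fsuc i) * h ^ suc (toℕ i)))) ⟩
  g fzero * (h * 1ℚ) + h * expansion h (λ i → g (fsuc i))
    ≡⟨ solve 3 (λ a h e → a :* (h :* con 1ℚ) :+ h :* e := h :* (a :+ e)) refl (g fzero) h _ ⟩
  h * (g fzero + expansion h (λ i → g (fsuc i))) ∎
  where open ≡-Reasoning

module _ {Y h : ℚ} (hY≡1 : h * Y ≡ 1ℚ) where

  private
    ∣h∣∣Y∣≡1 : ∣ h ∣ * ∣ Y ∣ ≡ 1ℚ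
    ∣h∣∣Y∣≡1 = trans (sym (ℚP.∣p*q∣≡∣p∣*∣q∣ h Y)) (cong ∣_∣ hY≡1)

    h≢0 : h ≢ 0ℚ
    h≢0 h≡0 = ℚP.1≢0 (trans (sym hY≡1) (trans (cong (_* Y) h≡0) (ℚP.*-zeroˡ Y)))

    h*p≡0⇒p≡0 : ∀ {p} → h * p ≡ 0ℚ → p ≡ 0ℚ
    h*p≡0⇒p≡0 {p} hp≡0 = begin
      p             ≡⟨ sym (ℚP.*-identityˡ p) ⟩
      1ℚ * p        ≡⟨ cong (_* p) (trans (sym hY≡1) (ℚP.*-comm h Y)) ⟩
      Y * h * p     ≡⟨ ℚP.*-assoc Y h p ⟩
      Y * (h * p)   ≡⟨ cong (Y *_) hp≡0 ⟩
      Y * 0ℚ        ≡⟨ ℚP.*-zeroʳ Y ⟩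
      0ℚ ∎
      where open ≡-Reasoning

  ∣expansion∣≤1-∣h∣^n : ∀ {n} (g : Fin n → ℚ) → (∀ i → ∣ g i ∣ + 1ℚ ≤ ∣ Y ∣) →
    ∣ expansion h g ∣ ≤ 1ℚ - ∣ h ∣ ^ n
  ∣expansion∣≤1-∣h∣^n {zero} _ _ = ℚP.≤-reflexive (sym (ℚP.+-inverseʳ 1ℚ))
  ∣expansion∣≤1-∣h∣^n {suc n} g small = begin
    ∣ expansion h g ∣                          ≡⟨ cong ∣_∣ (expansion-suc h g) ⟩
    ∣ h * (g fzero + tail) ∣                   ≡⟨ ℚP.∣p*q∣≡∣p∣*∣q∣ h _ ⟩
    ∣ h ∣ * ∣ g fzero + tail ∣                 ≤⟨ ℚP.*-monoˡ-≤-nonNeg ∣ h ∣ {{ℚP.∣-∣-nonNeg h}}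
                                                    (ℚP.≤-trans (ℚP.∣p+q∣≤∣p∣+∣q∣ (g fzero) tail)
                                                      (ℚP.+-mono-≤ ∣g₀∣≤∣Y∣-1 ∣tail∣≤)) ⟩
    ∣ h ∣ * ((∣ Y ∣ - 1ℚ) + (1ℚ - ∣ h ∣ ^ n))   ≡⟨ telescope ∣ h ∣ ∣ Y ∣ (∣ h ∣ ^ n) ⟩
    ∣ h ∣ * ∣ Y ∣ - ∣ h ∣ ^ suc n              ≡⟨ cong (_- ∣ h ∣ ^ suc n) ∣h∣∣Y∣≡1 ⟩
    1ℚ - ∣ h ∣ ^ suc n ∎
    where
    open ℚP.≤-Reasoning
    tail : ℚ
    tail = expansion h (λ i → g (fsuc i))
    ∣tail∣≤ : ∣ tail ∣ ≤ 1ℚ - ∣ h ∣ ^ n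
    ∣tail∣≤ = ∣expansion∣≤1-∣h∣^n (λ i → g (fsuc i)) (λ i → small (fsuc i))
    telescope : ∀ H Y P → H * ((Y - 1ℚ) + (1ℚ - P)) ≡ H * Y - H * P
    telescope = solve 3 (λ H Y P → H :* ((Y :- con 1ℚ) :+ (con 1ℚ :- P)) := H :* Y :- H :* P) refl
    ∣g₀∣≤∣Y∣-1 : ∣ g fzero ∣ ≤ ∣ Y ∣ - 1ℚ
    ∣g₀∣≤∣Y∣-1 = subst (_≤ ∣ Y ∣ - 1ℚ) (solve 1 (λ p → p :+ con 1ℚ :- con 1ℚ := p) refl ∣ g fzero ∣)
      (ℚP.+-monoˡ-≤ (- 1ℚ) (small fzero))

  expansion≡0⇒digits≡0 : ∀ {n} (g : Fin n → ℚ) → (∀ i → IsInteger (g i)) →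
    (∀ i → ∣ g i ∣ + 1ℚ ≤ ∣ Y ∣) → expansion h g ≡ 0ℚ → ∀ i → g i ≡ 0ℚ
  expansion≡0⇒digits≡0 {suc n} g integral small expansion≡0 = digit≡0
    where
    tail : ℚ
    tail = expansion h (λ i → g (fsuc i))
    g₀+tail≡0 : g fzero + tail ≡ 0ℚ
    g₀+tail≡0 = h*p≡0⇒p≡0 (trans (sym (expansion-suc h g)) expansion≡0)
    ∣tail∣<1 : ∣ tail ∣ < 1ℚ
    ∣tail∣<1 = ℚP.≤-<-trans (∣expansion∣≤1-∣h∣^n (λ i → g (fsuc i)) (λ i → small (fsuc i)))
      (subst (1ℚ - ∣ h ∣ ^ n <_) (ℚP.+-identityʳ 1ℚ)
        (ℚP.+-monoʳ-< 1ℚ (ℚP.neg-antimono-< (0<^ n (p≢0⇒0<∣p∣ h≢0)))))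
    tail≡0 : tail ≡ 0ℚ
    tail≡0 = IsInteger-∣∣<1⇒≡0
      (subst IsInteger (sym (inverseʳ-unique (g fzero) tail g₀+tail≡0)) (IsInteger-neg (integral fzero)))
      ∣tail∣<1
    digit≡0 : ∀ i → g i ≡ 0ℚ
    digit≡0 fzero =
      trans (sym (ℚP.+-identityʳ (g fzero))) (trans (cong (λ e → g fzero + e) (sym tail≡0)) g₀+tail≡0)
    digit≡0 (fsuc i) = expansion≡0⇒digits≡0 (λ i → g (fsuc i)) (λ i → integral (fsuc i))
      (λ i → small (fsuc i)) tail≡0 i

-- Arithmetic of K

module _ {d : ℕ} where

  δ : ℚ
  δ = dℚ {d}

  K-≡ : ∀ {x y : K d} → re x ≡ re y → im x ≡ im y → x ≡ y
  K-≡ {_ + _ √-d} {_ + _ √-d} refl refl = refl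

  infix 8 -ᴷ_
  -ᴷ_ : K d → K d
  -ᴷ (a + b √-d) = (- a) + (- b) √-d

  ⊕-assoc : ∀ (x y z : K d) → (x ⊕ y) ⊕ z ≡ x ⊕ (y ⊕ z)
  ⊕-assoc x y z = K-≡ (ℚP.+-assoc (re x) (re y) (re z)) (ℚP.+-assoc (im x) (im y) (im z))

  ⊕-comm : ∀ (x y : K d) → x ⊕ y ≡ y ⊕ x
  ⊕-comm x y = K-≡ (ℚP.+-comm (re x) (re y)) (ℚP.+-comm (im x) (im y))

  ⊕-identityˡ : ∀ (x : K d) → ι 0ℚ ⊕ x ≡ x
  ⊕-identityˡ x = K-≡ (ℚP.+-identityˡ (re x)) (ℚP.+-identityˡ (im x))

  ⊕-identityʳ : ∀ (x : K d) → x ⊕ ι 0ℚ ≡ x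
  ⊕-identityʳ x = K-≡ (ℚP.+-identityʳ (re x)) (ℚP.+-identityʳ (im x))

  ⊕-inverseˡ : ∀ (x : K d) → -ᴷ x ⊕ x ≡ ι 0ℚ
  ⊕-inverseˡ x = K-≡ (ℚP.+-inverseˡ (re x)) (ℚP.+-inverseˡ (im x))

  ⊕-inverseʳ : ∀ (x : K d) → x ⊕ -ᴷ x ≡ ι 0ℚ
  ⊕-inverseʳ x = K-≡ (ℚP.+-inverseʳ (re x)) (ℚP.+-inverseʳ (im x))

  ⊗-assoc : ∀ (x y z : K d) → (x ⊗ y) ⊗ z ≡ x ⊗ (y ⊗ z)
  ⊗-assoc (a + b √-d) (c + e √-d) (f + g √-d) = K-≡
    (solve 7 (λ a b c e f g D → (a :* c :- D :* (b :* e)) :* f :- D :* ((a :* e :+ b :* c) :* g)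
                             := a :* (c :* f :- D :* (e :* g)) :- D :* (b :* (c :* g :+ e :* f)))
             refl a b c e f g δ)
    (solve 7 (λ a b c e f g D → (a :* c :- D :* (b :* e)) :* g :+ (a :* e :+ b :* c) :* f
                             := a :* (c :* g :+ e :* f) :+ b :* (c :* f :- D :* (e :* g)))
             refl a b c e f g δ)

  ⊗-comm : ∀ (x y : K d) → x ⊗ y ≡ y ⊗ x
  ⊗-comm (a + b √-d) (c + e √-d) = K-≡
    (solve 5 (λ a b c e D → a :* c :- D :* (b :* e) := c :* a :- D :* (e :* b)) refl a b c e δ)
    (solve 4 (λ a b c e → a :* e :+ b :* c := c :* b :+ e :* a) refl a b c e)

  ⊗-identityˡ : ∀ (x : K d) → ι 1ℚ ⊗ x ≡ x
  ⊗-identityˡ (a + b √-d) = K-≡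
    (solve 3 (λ a b D → con 1ℚ :* a :- D :* (con 0ℚ :* b) := a) refl a b δ)
    (solve 2 (λ a b → con 1ℚ :* b :+ con 0ℚ :* a := b) refl a b)

  ⊗-identityʳ : ∀ (x : K d) → x ⊗ ι 1ℚ ≡ x
  ⊗-identityʳ x = trans (⊗-comm x (ι 1ℚ)) (⊗-identityˡ x)

  ⊗-distribˡ-⊕ : ∀ (x y z : K d) → x ⊗ (y ⊕ z) ≡ x ⊗ y ⊕ x ⊗ z
  ⊗-distribˡ-⊕ (a + b √-d) (c + e √-d) (f + g √-d) = K-≡
    (solve 7 (λ a b c e f g D → a :* (c :+ f) :- D :* (b :* (e :+ g))
                             := (a :* c :- D :* (b :* e)) :+ (a :* f :- D :* (b :* g)))
             refl a b c e f g δ)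
    (solve 6 (λ a b c e f g → a :* (e :+ g) :+ b :* (c :+ f)
                           := (a :* e :+ b :* c) :+ (a :* g :+ b :* f))
             refl a b c e f g)

  ⊗-distribʳ-⊕ : ∀ (x y z : K d) → (y ⊕ z) ⊗ x ≡ y ⊗ x ⊕ z ⊗ x
  ⊗-distribʳ-⊕ x y z = trans (⊗-comm (y ⊕ z) x)
    (trans (⊗-distribˡ-⊕ x y z) (cong₂ _⊕_ (⊗-comm x y) (⊗-comm x z)))

  K-commutativeRing : CommutativeRing 0ℓ 0ℓ
  K-commutativeRing = record
    { Carrier = K d
    ; _≈_ = _≡_
    ; _+_ = _⊕_
    ; _*_ = _⊗_
    ; -_ = -ᴷ_
    ; 0# = ι 0ℚ
    ; 1# = ι 1ℚ
    ; isCommutativeRing = record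
      { isRing = record
        { +-isAbelianGroup = record
          { isGroup = record
            { isMonoid = record
              { isSemigroup = record
                { isMagma = record { isEquivalence = isEquivalence ; ∙-cong = cong₂ _⊕_ }
                ; assoc = ⊕-assoc }
              ; identity = ⊕-identityˡ , ⊕-identityʳ }
            ; inverse = ⊕-inverseˡ , ⊕-inverseʳ
            ; ⁻¹-cong = cong -ᴷ_ }
          ; comm = ⊕-comm }
        ; *-cong = cong₂ _⊗_
        ; *-assoc = ⊗-assoc
        ; *-identity = ⊗-identityˡ , ⊗-identityʳ
        ; distrib = ⊗-distribˡ-⊕ , ⊗-distribʳ-⊕ }
      ; *-comm = ⊗-comm }
    }

  ι-⊗ : ∀ p q → ι {d} p ⊗ ι q ≡ ι (p * q)
  ι-⊗ p q = K-≡
    (solve 3 (λ p q D → p :* q :- D :* (con 0ℚ :* con 0ℚ) := p :* q) refl p q δ)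
    (solve 2 (λ p q → p :* con 0ℚ :+ con 0ℚ :* q := con 0ℚ) refl p q)

  ιℤ-homomorphism : ℤ.+-*-rawRing -Raw-AlmostCommutative⟶ fromCommutativeRing K-commutativeRing
  ιℤ-homomorphism = record
    { ⟦_⟧ = ιℤ
    ; +-homo = λ a b → K-≡ (/1-homo-+ a b) refl
    ; *-homo = λ a b → trans (cong ι (/1-homo-* a b)) (sym (ι-⊗ (a / 1) (b / 1)))
    ; -‿homo = λ a → K-≡ (/1-homo-neg a) refl
    ; 0-homo = refl
    ; 1-homo = refl
    }

  -- Coefficients are taken in ℤ: constants of K involve dℚ with d open, so the solver could not
  -- compute with them.
  open RingSolver ℤ.+-*-rawRing (fromCommutativeRing K-commutativeRing) ιℤ-homomorphism
    (λ a b → Maybe.map (cong ιℤ) (dec⇒maybe (a ℤP.≟ b)))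
    using ()
    renaming (solve to K-solve; _:+_ to _:⊕_; _:*_ to _:⊗_; :-_ to :⊝_; con to K-con; _:=_ to _:≡_)

  conj : K d → K d
  conj (a + b √-d) = a + (- b) √-d

  trace : K d → ℚ
  trace x = re x + re x

  norm : K d → ℚ
  norm x = re x * re x + δ * (im x * im x)

  ι-^ : ∀ p k → ι {d} p ^ᴷ k ≡ ι (p ^ k)
  ι-^ p zero = refl
  ι-^ p (suc k) = trans (cong (ι p ⊗_) (ι-^ p k)) (ι-⊗ p (p ^ k))

  ^ᴷ-distrib-⊗ : ∀ (x y : K d) k → (x ⊗ y) ^ᴷ k ≡ x ^ᴷ k ⊗ y ^ᴷ k
  ^ᴷ-distrib-⊗ x y zero = sym (⊗-identityˡ (ι 1ℚ))
  ^ᴷ-distrib-⊗ x y (suc k) = trans (cong ((x ⊗ y) ⊗_) (^ᴷ-distrib-⊗ x y k))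
    (K-solve 4 (λ x y p q → (x :⊗ y) :⊗ (p :⊗ q) :≡ (x :⊗ p) :⊗ (y :⊗ q))
             refl x y (x ^ᴷ k) (y ^ᴷ k))

  conj-⊗ : ∀ (x y : K d) → conj (x ⊗ y) ≡ conj x ⊗ conj y
  conj-⊗ (a + b √-d) (c + e √-d) = K-≡
    (solve 5 (λ a b c e D → a :* c :- D :* (b :* e) := a :* c :- D :* (:- b :* :- e)) refl a b c e δ)
    (solve 4 (λ a b c e → :- (a :* e :+ b :* c) := a :* :- e :+ :- b :* c) refl a b c e)

  conj-^ᴷ : ∀ (x : K d) k → conj (x ^ᴷ k) ≡ conj x ^ᴷ k
  conj-^ᴷ x zero = refl
  conj-^ᴷ x (suc k) = trans (conj-⊗ x (x ^ᴷ k)) (cong (conj x ⊗_) (conj-^ᴷ x k))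

  ⊕-conj : ∀ (x : K d) → x ⊕ conj x ≡ ι (trace x)
  ⊕-conj x = K-≡ refl (ℚP.+-inverseʳ (im x))

  ⊗-conj : ∀ (x : K d) → x ⊗ conj x ≡ ι (norm x)
  ⊗-conj x = K-≡
    (solve 3 (λ a b D → a :* a :- D :* (b :* :- b) := a :* a :+ D :* (b :* b)) refl (re x) (im x) δ)
    (solve 2 (λ a b → a :* :- b :+ b :* a := con 0ℚ) refl (re x) (im x))

  norm-⊗ : ∀ (x y : K d) → norm (x ⊗ y) ≡ norm x * norm y
  norm-⊗ x y = multiplicative (re x) (im x) (re y) (im y) δ
    where
    multiplicative : ∀ a b c e D →
      (a * c - D * (b * e)) * (a * c - D * (b * e)) + D * ((a * e + b * c) * (a * e + b * c))
        ≡ (a * a + D * (b * b)) * (c * c + D * (e * e))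
    multiplicative = solve 5 (λ a b c e D →
      (a :* c :- D :* (b :* e)) :* (a :* c :- D :* (b :* e))
        :+ D :* ((a :* e :+ b :* c) :* (a :* e :+ b :* c))
      := (a :* a :+ D :* (b :* b)) :* (c :* c :+ D :* (e :* e))) refl

  norm-ι : ∀ q → norm (ι q) ≡ q * q
  norm-ι q = solve 2 (λ q D → q :* q :+ D :* (con 0ℚ :* con 0ℚ) := q :* q) refl q δ

  norm-^ᴷ : ∀ (x : K d) k → norm (x ^ᴷ k) ≡ norm x ^ k
  norm-^ᴷ x zero = norm-ι 1ℚ
  norm-^ᴷ x (suc k) = trans (norm-⊗ x (x ^ᴷ k)) (cong (norm x *_) (norm-^ᴷ x k))

  norm-prodK : ∀ n (f : Fin n → K d) → norm (prodK n f) ≡ product (λ i → norm (f i))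
  norm-prodK zero f = norm-ι 1ℚ
  norm-prodK (suc n) f =
    trans (norm-⊗ (f fzero) _) (cong (norm (f fzero) *_) (norm-prodK n (λ i → f (fsuc i))))

  0≤δ : 0ℚ ≤ δ
  0≤δ = /1-mono-≤ {+ 0} {+ d} (ℤ.+≤+ ℕ.z≤n)

  re*re≤norm : ∀ (x : K d) → re x * re x ≤ norm x
  re*re≤norm x = subst (_≤ norm x) (ℚP.+-identityʳ (re x * re x))
    (ℚP.+-monoʳ-≤ (re x * re x) (0≤* 0≤δ (0≤p*p (im x))))

  0≤norm : ∀ (x : K d) → 0ℚ ≤ norm x
  0≤norm x = ℚP.≤-trans (0≤p*p (re x)) (re*re≤norm x)

  invℚ-inverseˡ : ∀ {p} → p ≢ 0ℚ → invℚ {d} p * p ≡ 1ℚ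
  invℚ-inverseˡ {p} p≢0 with p ℚP.≟ 0ℚ
  ... | yes p≡0 = contradiction p≡0 p≢0
  ... | no p≢0 = ℚP.*-inverseˡ p {{≢-nonZero p≢0}}

  invℚ-inverseʳ : ∀ {p} → p ≢ 0ℚ → p * invℚ {d} p ≡ 1ℚ
  invℚ-inverseʳ {p} p≢0 = trans (ℚP.*-comm p _) (invℚ-inverseˡ p≢0)

  invℚ-unique : ∀ {p q} → p * q ≡ 1ℚ → invℚ {d} p ≡ q
  invℚ-unique {p} {q} pq≡1 = begin
    invℚ {d} p            ≡⟨ sym (ℚP.*-identityʳ (invℚ {d} p)) ⟩
    invℚ {d} p * 1ℚ       ≡⟨ cong (invℚ {d} p *_) (sym pq≡1) ⟩
    invℚ {d} p * (p * q)  ≡⟨ sym (ℚP.*-assoc (invℚ {d} p) p q) ⟩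
    invℚ {d} p * p * q    ≡⟨ cong (_* q) (invℚ-inverseˡ p≢0) ⟩
    1ℚ * q                ≡⟨ ℚP.*-identityˡ q ⟩
    q ∎
    where
    open ≡-Reasoning
    p≢0 : p ≢ 0ℚ
    p≢0 p≡0 = ℚP.1≢0 (trans (sym pq≡1) (trans (cong (_* q) p≡0) (ℚP.*-zeroˡ q)))

  0≤invℚ : ∀ {p} → 0ℚ ≤ p → 0ℚ ≤ invℚ {d} p
  0≤invℚ {p} 0≤p with p ℚP.≟ 0ℚ
  ... | yes _ = ℚP.≤-refl
  ... | no p≢0 = ℚP.nonNegative⁻¹ 1/p {{ℚP.pos⇒nonNeg 1/p {{ℚP.1/pos⇒pos p {{p>0}}}}}}
    where
    1/p : ℚ
    1/p = 1/_ p {{≢-nonZero p≢0}}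
    p>0 : Positive p
    p>0 = ℚP.nonNeg∧nonZero⇒pos p {{nonNegative 0≤p}} {{≢-nonZero p≢0}}

  -- With the convention invℚ 0 = 0, the next three identities need no non-zero hypothesis.
  invℚ-* : ∀ p q → invℚ {d} (p * q) ≡ invℚ {d} p * invℚ {d} q
  invℚ-* p q = by-cases (p ℚP.≟ 0ℚ) (q ℚP.≟ 0ℚ)
    where
    by-cases : Dec (p ≡ 0ℚ) → Dec (q ≡ 0ℚ) → invℚ {d} (p * q) ≡ invℚ {d} p * invℚ {d} q
    by-cases (yes refl) _ = trans (cong (invℚ {d}) (ℚP.*-zeroˡ q)) (sym (ℚP.*-zeroˡ (invℚ {d} q)))
    by-cases _ (yes refl) = trans (cong (invℚ {d}) (ℚP.*-zeroʳ p)) (sym (ℚP.*-zeroʳ (invℚ {d} p)))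
    by-cases (no p≢0) (no q≢0) = invℚ-unique {p * q} {invℚ {d} p * invℚ {d} q}
      (trans (solve 4 (λ p q p⁻¹ q⁻¹ → p :* q :* (p⁻¹ :* q⁻¹) := (p :* p⁻¹) :* (q :* q⁻¹))
                      refl p q (invℚ {d} p) (invℚ {d} q))
             (cong₂ _*_ (invℚ-inverseʳ p≢0) (invℚ-inverseʳ q≢0)))

  invℚ-^ : ∀ p k → invℚ {d} (p ^ k) ≡ invℚ {d} p ^ k
  invℚ-^ p zero = refl
  invℚ-^ p (suc k) = trans (invℚ-* p (p ^ k)) (cong (invℚ {d} p *_) (invℚ-^ p k))

  *-invℚ-invℚ : ∀ p → p * invℚ {d} p * invℚ {d} p ≡ invℚ {d} p
  *-invℚ-invℚ p = by-cases (p ℚP.≟ 0ℚ)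
    where
    by-cases : Dec (p ≡ 0ℚ) → p * invℚ {d} p * invℚ {d} p ≡ invℚ {d} p
    by-cases (yes refl) = refl
    by-cases (no p≢0) =
      trans (cong (_* invℚ {d} p) (invℚ-inverseʳ p≢0)) (ℚP.*-identityˡ (invℚ {d} p))

  inv-ι : ∀ q → inv (ι {d} q) ≡ ι (invℚ {d} q)
  inv-ι q = K-≡ re-inv (ℚP.*-zeroˡ (invℚ {d} (q * q + δ * (0ℚ * 0ℚ))))
    where
    open ≡-Reasoning
    re-inv : q * invℚ {d} (q * q + δ * (0ℚ * 0ℚ)) ≡ invℚ {d} q
    re-inv = begin
      q * invℚ {d} (q * q + δ * (0ℚ * 0ℚ))  ≡⟨ cong (λ e → q * invℚ {d} e) (norm-ι q) ⟩
      q * invℚ {d} (q * q)                   ≡⟨ cong (q *_) (invℚ-* q q) ⟩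
      q * (invℚ {d} q * invℚ {d} q)          ≡⟨ sym (ℚP.*-assoc q (invℚ {d} q) (invℚ {d} q)) ⟩
      q * invℚ {d} q * invℚ {d} q            ≡⟨ *-invℚ-invℚ q ⟩
      invℚ {d} q ∎

  norm-inv : ∀ (x : K d) → norm (inv x) ≡ invℚ {d} (norm x)
  norm-inv x = trans
    (solve 4 (λ a b D I → (a :* I) :* (a :* I) :+ D :* ((:- b :* I) :* (:- b :* I))
                       := (a :* a :+ D :* (b :* b)) :* I :* I)
             refl (re x) (im x) δ (invℚ {d} (norm x)))
    (*-invℚ-invℚ (norm x))

  im-⊗-ι : ∀ (x : K d) c → im (x ⊗ ι c) ≡ im x * c
  im-⊗-ι x c = solve 3 (λ a b c → a :* con 0ℚ :+ b :* c := b :* c) refl (re x) (im x) c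

  im-sumK : ∀ n (f : Fin n → K d) → im (sumK n f) ≡ sum (λ i → im (f i))
  im-sumK zero f = refl
  im-sumK (suc n) f = cong (λ e → im (f fzero) + e) (im-sumK n (λ i → f (fsuc i)))

  InQ-⊕ : ∀ {x y : K d} → InQ x → InQ y → InQ (x ⊕ y)
  InQ-⊕ x∈ℚ y∈ℚ = cong₂ _+_ x∈ℚ y∈ℚ

  InQ-⊗ : ∀ {x y : K d} → InQ x → InQ y → InQ (x ⊗ y)
  InQ-⊗ {x} {y} x∈ℚ y∈ℚ = trans (cong₂ (λ b e → re x * e + b * re y) x∈ℚ y∈ℚ)
    (solve 2 (λ a c → a :* con 0ℚ :+ con 0ℚ :* c := con 0ℚ) refl (re x) (re y))

  InQ-inv : ∀ {x : K d} → InQ x → InQ (inv x)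
  InQ-inv {x} x∈ℚ = trans (cong (λ b → - b * invℚ {d} (re x * re x + δ * (b * b))) x∈ℚ)
    (ℚP.*-zeroˡ (invℚ {d} (re x * re x + δ * (0ℚ * 0ℚ))))

  InQ-^ᴷ : ∀ {x : K d} k → InQ x → InQ (x ^ᴷ k)
  InQ-^ᴷ zero _ = refl
  InQ-^ᴷ {x} (suc k) x∈ℚ = InQ-⊗ {x} x∈ℚ (InQ-^ᴷ k x∈ℚ)

  InQ-prodK : ∀ n {f : Fin n → K d} → (∀ i → InQ (f i)) → InQ (prodK n f)
  InQ-prodK zero _ = refl
  InQ-prodK (suc n) {f} f∈ℚ = InQ-⊗ {f fzero} (f∈ℚ fzero) (InQ-prodK n (λ i → f∈ℚ (fsuc i)))

  InQ-sumK : ∀ n {f : Fin n → K d} → (∀ i → InQ (f i)) → InQ (sumK n f)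
  InQ-sumK zero _ = refl
  InQ-sumK (suc n) {f} f∈ℚ =
    InQ-⊕ {f fzero} {sumK n (λ i → f (fsuc i))} (f∈ℚ fzero) (InQ-sumK n (λ i → f∈ℚ (fsuc i)))

  -- Denominators and algebraic integers

  record CommonDenominator (E : ℕ) (x : K d) : Set where
    constructor _,_
    field
      re-integral : IsInteger (+ E / 1 * re x)
      im-integral : IsInteger (+ E / 1 * im x)
  open CommonDenominator

  CommonDenominator-ι : ∀ {E q} → IsInteger q → CommonDenominator E (ι q)
  CommonDenominator-ι {E} q∈ℤ = IsInteger-* (+ E , refl) q∈ℤ , IsInteger-* (+ E , refl) (+ 0 , refl)

  CommonDenominator-conj : ∀ {E x} → CommonDenominator E x → CommonDenominator E (conj x)
  CommonDenominator-conj {E} {x} (re∈ℤ , im∈ℤ) =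
    re∈ℤ , subst IsInteger (ℚP.neg-distribʳ-* (+ E / 1) (im x)) (IsInteger-neg im∈ℤ)

  CommonDenominator-⊕ : ∀ {E x y} →
    CommonDenominator E x → CommonDenominator E y → CommonDenominator E (x ⊕ y)
  CommonDenominator-⊕ {E} {x} {y} (a , b) (c , e) =
    subst IsInteger (sym (ℚP.*-distribˡ-+ (+ E / 1) (re x) (re y))) (IsInteger-+ a c) ,
    subst IsInteger (sym (ℚP.*-distribˡ-+ (+ E / 1) (im x) (im y))) (IsInteger-+ b e)

  CommonDenominator-cancelˡ : ∀ {E x y} →
    CommonDenominator E (x ⊕ y) → CommonDenominator E x → CommonDenominator E y
  CommonDenominator-cancelˡ {E} {x} {y} (a , b) (c , e) =
    subst IsInteger (difference (+ E / 1) (re x) (re y)) (IsInteger-+ a (IsInteger-neg c)) ,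
    subst IsInteger (difference (+ E / 1) (im x) (im y)) (IsInteger-+ b (IsInteger-neg e))
    where
    difference : ∀ E p q → E * (p + q) + - (E * p) ≡ E * q
    difference = solve 3 (λ E p q → E :* (p :+ q) :+ :- (E :* p) := E :* q) refl

  CommonDenominator-⊗ : ∀ {E F x y} → CommonDenominator E x → CommonDenominator F y →
    CommonDenominator (E ℕ.* F) (x ⊗ y)
  CommonDenominator-⊗ {E} {F} {x} {y} (a , b) (c , e) =
    subst IsInteger (sym (trans (cong (_* re (x ⊗ y)) (+/1-homo-* E F))
                         (re-expand (+ E / 1) (+ F / 1) (re x) (im x) (re y) (im y) δ)))
      (IsInteger-+ (IsInteger-* a c) (IsInteger-neg (IsInteger-* (+ d , refl) (IsInteger-* b e)))) ,
    subst IsInteger (sym (trans (cong (_* im (x ⊗ y)) (+/1-homo-* E F))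
                         (im-expand (+ E / 1) (+ F / 1) (re x) (im x) (re y) (im y))))
      (IsInteger-+ (IsInteger-* a e) (IsInteger-* b c))
    where
    re-expand : ∀ E F a b c e D →
      E * F * (a * c - D * (b * e)) ≡ E * a * (F * c) + - (D * (E * b * (F * e)))
    re-expand = solve 7 (λ E F a b c e D →
      E :* F :* (a :* c :- D :* (b :* e)) := E :* a :* (F :* c) :+ :- (D :* (E :* b :* (F :* e)))) refl
    im-expand : ∀ E F a b c e → E * F * (a * e + b * c) ≡ E * a * (F * e) + E * b * (F * c)
    im-expand = solve 6 (λ E F a b c e →
      E :* F :* (a :* e :+ b :* c) := E :* a :* (F :* e) :+ E :* b :* (F :* c)) refl

  CommonDenominator-* : ∀ {E x} F → CommonDenominator E x → CommonDenominator (E ℕ.* F) x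
  CommonDenominator-* {E} {x} F cd = subst (CommonDenominator (E ℕ.* F)) (⊗-identityʳ x)
    (CommonDenominator-⊗ cd (CommonDenominator-ι {F} (+ 1 , refl)))

  CommonDenominator-denominators : ∀ x → CommonDenominator (↧ₙ re x ℕ.* ↧ₙ im x) x
  CommonDenominator-denominators x =
    subst IsInteger (sym (trans (cong (_* re x) (+/1-homo-* s t))
      (trans (solve 3 (λ S T a → S :* T :* a := T :* (a :* S)) refl (+ s / 1) (+ t / 1) (re x))
        (cong (+ t / 1 *_) (*-denominator (re x))))))
      (IsInteger-* (+ t , refl) (↥ re x , refl)) ,
    subst IsInteger (sym (trans (cong (_* im x) (+/1-homo-* s t))
      (trans (ℚP.*-assoc (+ s / 1) (+ t / 1) (im x))
        (cong (+ s / 1 *_) (trans (ℚP.*-comm (+ t / 1) (im x)) (*-denominator (im x)))))))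
      (IsInteger-* (+ s , refl) (↥ im x , refl))
    where
    s t : ℕ
    s = ↧ₙ re x
    t = ↧ₙ im x

  BoundedDenominators : K d → Set
  BoundedDenominators x = Σ ℕ λ E → E ≢ 0 × (∀ k → CommonDenominator E (x ^ᴷ k))

  private
    *≢0 : ∀ {m n} → m ≢ 0 → n ≢ 0 → m ℕ.* n ≢ 0
    *≢0 {m} m≢0 n≢0 mn≡0 with ℕP.m*n≡0⇒m≡0∨n≡0 m mn≡0
    ... | inj₁ m≡0 = m≢0 m≡0
    ... | inj₂ n≡0 = n≢0 n≡0

  BoundedDenominators-ι⇒IsInteger : ∀ {q} → BoundedDenominators (ι q) → IsInteger q
  BoundedDenominators-ι⇒IsInteger {q} (E , E≢0 , cd) = IsInteger-of-bounded-powers E≢0 q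
    (λ k → subst (λ z → IsInteger (+ E / 1 * re z)) (ι-^ q k) (re-integral (cd k)))

  BoundedDenominators-conj : ∀ {x} → BoundedDenominators x → BoundedDenominators (conj x)
  BoundedDenominators-conj {x} (E , E≢0 , cd) =
    E , E≢0 , λ k → subst (CommonDenominator E) (conj-^ᴷ x k) (CommonDenominator-conj (cd k))

  BoundedDenominators-⊗ : ∀ {x y} →
    BoundedDenominators x → BoundedDenominators y → BoundedDenominators (x ⊗ y)
  BoundedDenominators-⊗ {x} {y} (E , E≢0 , cdx) (F , F≢0 , cdy) = E ℕ.* F , *≢0 E≢0 F≢0 ,
    λ k → subst (CommonDenominator (E ℕ.* F)) (sym (^ᴷ-distrib-⊗ x y k))
            (CommonDenominator-⊗ (cdx k) (cdy k))

  BoundedDenominators-⊕ : ∀ {x y} →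
    BoundedDenominators x → BoundedDenominators y → BoundedDenominators (x ⊕ y)
  BoundedDenominators-⊕ {x} {y} (E , E≢0 , cdx) (F , F≢0 , cdy) = E ℕ.* F , *≢0 E≢0 F≢0 ,
    λ k → subst (CommonDenominator (E ℕ.* F))
            (trans (cong ((x ⊕ y) ^ᴷ k ⊗_) (⊗-identityˡ (ι 1ℚ))) (⊗-identityʳ _)) (binomial k 0 0)
    where
    binomial : ∀ k i j → CommonDenominator (E ℕ.* F) ((x ⊕ y) ^ᴷ k ⊗ (x ^ᴷ i ⊗ y ^ᴷ j))
    binomial zero i j =
      subst (CommonDenominator (E ℕ.* F)) (sym (⊗-identityˡ _)) (CommonDenominator-⊗ (cdx i) (cdy j))
    binomial (suc k) i j = subst (CommonDenominator (E ℕ.* F))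
      (K-solve 5 (λ x y P A B → P :⊗ ((x :⊗ A) :⊗ B) :⊕ P :⊗ (A :⊗ (y :⊗ B))
                            :≡ ((x :⊕ y) :⊗ P) :⊗ (A :⊗ B))
               refl x y ((x ⊕ y) ^ᴷ k) (x ^ᴷ i) (y ^ᴷ j))
      (CommonDenominator-⊕ (binomial k (suc i) j) (binomial k i (suc j)))

  BoundedDenominators-prodK : ∀ n {f : Fin n → K d} → (∀ i → BoundedDenominators (f i)) →
    BoundedDenominators (prodK n f)
  BoundedDenominators-prodK zero _ = 1 , (λ ()) ,
    λ k → subst (CommonDenominator 1) (sym (ι-^ 1ℚ k)) (CommonDenominator-ι (IsInteger-^ k (+ 1 , refl)))
  BoundedDenominators-prodK (suc n) bd =
    BoundedDenominators-⊗ (bd fzero) (BoundedDenominators-prodK n (λ i → bd (fsuc i)))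

  BoundedDenominators⇒integral-trace : ∀ {x} → BoundedDenominators x → IsInteger (trace x)
  BoundedDenominators⇒integral-trace {x} bd = BoundedDenominators-ι⇒IsInteger
    (subst BoundedDenominators (⊕-conj x) (BoundedDenominators-⊕ bd (BoundedDenominators-conj bd)))

  BoundedDenominators⇒integral-norm : ∀ {x} → BoundedDenominators x → IsInteger (norm x)
  BoundedDenominators⇒integral-norm {x} bd = BoundedDenominators-ι⇒IsInteger
    (subst BoundedDenominators (⊗-conj x) (BoundedDenominators-⊗ bd (BoundedDenominators-conj bd)))

  -- x^j · p(x) is x^(j+m) plus an integral combination of x^j, …, x^(j+m-1), for p monic of degree m.
  powers-reduce : ∀ {E x} cs j → (∀ i → i ℕ.< length cs → CommonDenominator E (x ^ᴷ (j ℕ.+ i))) →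
    CommonDenominator E (x ^ᴷ j ⊗ evalMonic cs x) → CommonDenominator E (x ^ᴷ (j ℕ.+ length cs))
  powers-reduce {E} {x} [] j _ cd =
    subst (CommonDenominator E) (trans (⊗-identityʳ _) (cong (x ^ᴷ_) (sym (ℕP.+-identityʳ j)))) cd
  powers-reduce {E} {x} (c ∷ cs) j lower cd = subst (λ k → CommonDenominator E (x ^ᴷ k))
    (sym (ℕP.+-suc j (length cs))) (powers-reduce {x = x} cs (suc j) higher cd′)
    where
    higher : ∀ i → i ℕ.< length cs → CommonDenominator E (x ^ᴷ (suc j ℕ.+ i))
    higher i i<m = subst (λ k → CommonDenominator E (x ^ᴷ k)) (ℕP.+-suc j i) (lower (suc i) (ℕ.s≤s i<m))
    c⊗xʲ : CommonDenominator E (ιℤ c ⊗ x ^ᴷ j)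
    c⊗xʲ = subst (λ F → CommonDenominator F (ιℤ c ⊗ x ^ᴷ j)) (ℕP.*-identityˡ E)
      (CommonDenominator-⊗ (CommonDenominator-ι {1} (c , refl))
        (subst (λ k → CommonDenominator E (x ^ᴷ k)) (ℕP.+-identityʳ j) (lower 0 (ℕ.s≤s ℕ.z≤n))))
    cd′ : CommonDenominator E (x ^ᴷ suc j ⊗ evalMonic cs x)
    cd′ = CommonDenominator-cancelˡ
      (subst (CommonDenominator E)
        (K-solve 4 (λ X C x P → X :⊗ (C :⊕ x :⊗ P) :≡ C :⊗ X :⊕ (x :⊗ X) :⊗ P)
                 refl (x ^ᴷ j) (ιℤ c) x (evalMonic cs x))
        cd)
      c⊗xʲ

  IsAlgInt⇒BoundedDenominators : ∀ {x} → IsAlgInt x → BoundedDenominators x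
  IsAlgInt⇒BoundedDenominators {x} (cs , root) =
    E , ℕ.≢-nonZero⁻¹ E {{ℕP.m^n≢0 D₀ m {{ℕP.m*n≢0 (↧ₙ re x) (↧ₙ im x)}}}} , <-rec _ power
    where
    m D₀ E : ℕ
    m = length cs
    D₀ = ↧ₙ re x ℕ.* ↧ₙ im x
    E = D₀ ℕ.^ m
    low : ∀ k → k ℕ.≤ m → CommonDenominator E (x ^ᴷ k)
    low k k≤m = subst (λ F → CommonDenominator F (x ^ᴷ k))
      (trans (sym (ℕP.^-distribˡ-+-* D₀ k (m ℕ.∸ k))) (cong (D₀ ℕ.^_) (ℕP.m+[n∸m]≡n k≤m)))
      (CommonDenominator-* (D₀ ℕ.^ (m ℕ.∸ k)) (powers k))
      where
      powers : ∀ k → CommonDenominator (D₀ ℕ.^ k) (x ^ᴷ k)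
      powers zero = CommonDenominator-ι (+ 1 , refl)
      powers (suc k) = CommonDenominator-⊗ (CommonDenominator-denominators x) (powers k)
    power : ∀ k → (∀ {i} → i ℕ.< k → CommonDenominator E (x ^ᴷ i)) → CommonDenominator E (x ^ᴷ k)
    power k rec with k ℕP.≤? m
    ... | yes k≤m = low k k≤m
    ... | no k≰m =
      subst (λ i → CommonDenominator E (x ^ᴷ i)) j+m≡k (powers-reduce cs j lower at-root)
      where
      j : ℕ
      j = k ℕ.∸ m
      j+m≡k : j ℕ.+ m ≡ k
      j+m≡k = ℕP.m∸n+n≡m (ℕP.<⇒≤ (ℕP.≰⇒> k≰m))
      lower : ∀ i → i ℕ.< m → CommonDenominator E (x ^ᴷ (j ℕ.+ i))
      lower i i<m = rec (subst (j ℕ.+ i ℕ.<_) j+m≡k (ℕP.+-monoʳ-< j i<m))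
      at-root : CommonDenominator E (x ^ᴷ j ⊗ evalMonic cs x)
      at-root = subst (CommonDenominator E)
        (sym (trans (cong (x ^ᴷ j ⊗_) root)
          (K-solve 1 (λ X → X :⊗ K-con (+ 0) :≡ K-con (+ 0)) refl (x ^ᴷ j))))
        (CommonDenominator-ι (+ 0 , refl))

  integral-trace-norm⇒IsAlgInt : ∀ {x : K d} →
    IsInteger (trace x) → IsInteger (norm x) → IsAlgInt x
  integral-trace-norm⇒IsAlgInt {x} (t , trace≡t) (n , norm≡n) = (n ∷ ℤ.- t ∷ []) , root
    where
    n≡x⊗x̄ : ιℤ n ≡ x ⊗ conj x
    n≡x⊗x̄ = trans (cong ι (sym norm≡n)) (sym (⊗-conj x))
    -t≡-[x⊕x̄] : ιℤ (ℤ.- t) ≡ -ᴷ (x ⊕ conj x)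
    -t≡-[x⊕x̄] = trans (cong ι (trans (/1-homo-neg t) (cong -_ (sym trace≡t))))
                      (cong -ᴷ_ (sym (⊕-conj x)))
    root : evalMonic (n ∷ ℤ.- t ∷ []) x ≡ ι 0ℚ
    root = trans (cong₂ (λ p q → p ⊕ x ⊗ (q ⊕ x ⊗ ι 1ℚ)) n≡x⊗x̄ -t≡-[x⊕x̄])
      (K-solve 2 (λ x x̄ → (x :⊗ x̄) :⊕ x :⊗ ((:⊝ (x :⊕ x̄)) :⊕ x :⊗ K-con (+ 1)) :≡ K-con (+ 0))
               refl x (conj x))

  integral-trace-norm⇒integral-2im : SquareFree d → ∀ {x : K d} →
    IsInteger (trace x) → IsInteger (norm x) → IsInteger (im x + im x)
  integral-trace-norm⇒integral-2im squarefree {x} trace∈ℤ norm∈ℤ =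
    IsInteger-of-squarefree-multiple squarefree (im x + im x)
      (subst IsInteger (sym (discriminant (re x) (im x) δ))
        (IsInteger-+ (IsInteger-+ (IsInteger-+ norm∈ℤ norm∈ℤ) (IsInteger-+ norm∈ℤ norm∈ℤ))
                     (IsInteger-neg (IsInteger-* trace∈ℤ trace∈ℤ))))
    where
    discriminant : ∀ a b D → D * ((b + b) * (b + b))
      ≡ ((a * a + D * (b * b)) + (a * a + D * (b * b))) + ((a * a + D * (b * b)) + (a * a + D * (b * b)))
        + - ((a + a) * (a + a))
    discriminant = solve 3 (λ a b D → D :* ((b :+ b) :* (b :+ b))
      := ((a :* a :+ D :* (b :* b)) :+ (a :* a :+ D :* (b :* b)))
         :+ ((a :* a :+ D :* (b :* b)) :+ (a :* a :+ D :* (b :* b)))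
         :+ :- ((a :+ a) :* (a :+ a))) refl

  -- The factors 3x + 1

  3x+1 : K d → K d
  3x+1 x = ι (+ 3 / 1) ⊗ x ⊕ ι (+ 1 / 1)

  re-3x+1 : ∀ x → re (3x+1 x) ≡ + 3 / 1 * re x + 1ℚ
  re-3x+1 x = solve 3 (λ a b D → con (+ 3 / 1) :* a :- D :* (con 0ℚ :* b) :+ con 1ℚ
                              := con (+ 3 / 1) :* a :+ con 1ℚ) refl (re x) (im x) δ

  im-3x+1 : ∀ x → im (3x+1 x) ≡ + 3 / 1 * im x
  im-3x+1 x = solve 2 (λ a b → con (+ 3 / 1) :* b :+ con 0ℚ :* a :+ con 0ℚ := con (+ 3 / 1) :* b)
                      refl (re x) (im x)

  trace-3x+1 : ∀ x → trace (3x+1 x) ≡ + 3 / 1 * trace x + + 2 / 1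
  trace-3x+1 x = trans (cong₂ _+_ (re-3x+1 x) (re-3x+1 x))
    (solve 1 (λ a → (con (+ 3 / 1) :* a :+ con 1ℚ) :+ (con (+ 3 / 1) :* a :+ con 1ℚ)
                 := con (+ 3 / 1) :* (a :+ a) :+ con (+ 2 / 1)) refl (re x))

  norm-3x+1 : ∀ x → norm (3x+1 x) ≡ + 3 / 1 * (+ 3 / 1 * norm x + trace x) + 1ℚ
  norm-3x+1 x = trans (cong₂ (λ a b → a * a + δ * (b * b)) (re-3x+1 x) (im-3x+1 x))
    (solve 3 (λ a b D → (con (+ 3 / 1) :* a :+ con 1ℚ) :* (con (+ 3 / 1) :* a :+ con 1ℚ)
                        :+ D :* ((con (+ 3 / 1) :* b) :* (con (+ 3 / 1) :* b))
                     := con (+ 3 / 1) :* (con (+ 3 / 1) :* (a :* a :+ D :* (b :* b)) :+ (a :+ a))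
                        :+ con 1ℚ)
             refl (re x) (im x) δ)

  9norm≡norm-3x+1-trace-3x+1+1 : ∀ x → + 9 / 1 * norm x ≡ norm (3x+1 x) - trace (3x+1 x) + 1ℚ
  9norm≡norm-3x+1-trace-3x+1+1 x = trans
    (solve 2 (λ N T → con (+ 9 / 1) :* N
                   := con (+ 3 / 1) :* (con (+ 3 / 1) :* N :+ T) :+ con 1ℚ
                      :- (con (+ 3 / 1) :* T :+ con (+ 2 / 1)) :+ con 1ℚ)
             refl (norm x) (trace x))
    (sym (cong₂ (λ N T → N - T + 1ℚ) (norm-3x+1 x) (trace-3x+1 x)))

  IsInteger-trace-3x+1 : ∀ {x} → IsInteger (trace x) → IsInteger (trace (3x+1 x))
  IsInteger-trace-3x+1 {x} trace∈ℤ = subst IsInteger (sym (trace-3x+1 x))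
    (IsInteger-+ (IsInteger-* (+ 3 , refl) trace∈ℤ) (+ 2 , refl))

  IsInteger-norm-3x+1 : ∀ {x} → IsInteger (trace x) → IsInteger (norm x) → IsInteger (norm (3x+1 x))
  IsInteger-norm-3x+1 {x} trace∈ℤ norm∈ℤ = subst IsInteger (sym (norm-3x+1 x))
    (IsInteger-+ (IsInteger-* (+ 3 , refl) (IsInteger-+ (IsInteger-* (+ 3 , refl) norm∈ℤ) trace∈ℤ))
                 (+ 1 , refl))

  -- N(3x + 1) = 3Z + 1 with Z ∈ ℤ; as the norm is non-negative, Z ≥ 0.
  1≤norm-3x+1 : ∀ {x} → IsInteger (trace x) → IsInteger (norm x) → 1ℚ ≤ norm (3x+1 x)
  1≤norm-3x+1 {x} trace∈ℤ norm∈ℤ = subst (1ℚ ≤_) (sym (norm-3x+1 x))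
    (subst (_≤ + 3 / 1 * Z + 1ℚ) (ℚP.+-identityˡ 1ℚ) (ℚP.+-monoˡ-≤ 1ℚ (0≤* 0≤3 0≤Z)))
    where
    Z : ℚ
    Z = + 3 / 1 * norm x + trace x
    Z∈ℤ : IsInteger Z
    Z∈ℤ = IsInteger-+ (IsInteger-* (+ 3 , refl) norm∈ℤ) trace∈ℤ
    0≤3 : 0ℚ ≤ + 3 / 1
    0≤3 = /1-mono-≤ {+ 0} {+ 3} (ℤ.+≤+ ℕ.z≤n)
    3Z+1<0 : Z + 1ℚ ≤ 0ℚ → + 3 / 1 * Z + 1ℚ < 0ℚ
    3Z+1<0 Z+1≤0 = ℚP.≤-<-trans
      (subst (_≤ + 3 / 1 * 0ℚ + -[1+ 1 ] / 1)
        (solve 1 (λ Z → con (+ 3 / 1) :* (Z :+ con 1ℚ) :+ con (-[1+ 1 ] / 1)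
                     := con (+ 3 / 1) :* Z :+ con 1ℚ) refl Z)
        (ℚP.+-monoˡ-≤ (-[1+ 1 ] / 1) (ℚP.*-monoˡ-≤-nonNeg (+ 3 / 1) Z+1≤0)))
      (toWitness {a? = + 3 / 1 * 0ℚ + -[1+ 1 ] / 1 ℚP.<? 0ℚ} _)
    0≤Z : 0ℚ ≤ Z
    0≤Z = ℚP.≮⇒≥ λ Z<0 → <⇒≱ (3Z+1<0 (IsInteger-<⇒+1≤ Z∈ℤ (+ 0 , refl) Z<0))
                              (subst (0ℚ ≤_) (norm-3x+1 x) (0≤norm (3x+1 x)))

  9norm≤4norm-3x+1 : ∀ x → 1ℚ ≤ norm (3x+1 x) → + 9 / 1 * norm x ≤ + 4 / 1 * norm (3x+1 x)
  9norm≤4norm-3x+1 x 1≤N = subst (_≤ + 4 / 1 * norm (3x+1 x)) (sym (9norm≡norm-3x+1-trace-3x+1+1 x))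
    (U-2A+1≤4U {A = re (3x+1 x)} (re*re≤norm (3x+1 x)) 1≤N)

im*im≤norm : ∀ {d′} (x : K (suc d′)) → im x * im x ≤ norm x
im*im≤norm {d′} x = subst (_≤ norm x) (ℚP.+-identityˡ (im x * im x))
  (ℚP.+-mono-≤ (0≤p*p (re x))
    (subst (_≤ δ {suc d′} * (im x * im x)) (ℚP.*-identityˡ (im x * im x))
      (ℚP.*-monoʳ-≤-nonNeg (im x * im x) {{nonNegative (0≤p*p (im x))}} 1≤δ)))
  where
  1≤δ : 1ℚ ≤ δ {suc d′}
  1≤δ = /1-mono-≤ {+ 1} {+ suc d′} (ℤ.+≤+ (ℕ.s≤s ℕ.z≤n))

-- The number y + Σ x_k / y^k

module _ {d′ : ℕ} (squarefree : SquareFree (suc d′)) {n : ℕ} (x : Fin n → K (suc d′))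
         (alg : ∀ k → IsAlgInt (x k)) where

  private
    u z : Fin n → K (suc d′)
    w y S : K (suc d′)
    u k = 3x+1 (x k)
    w = prodK n u
    y = ι (+ 2 / 1) ⊗ w
    z k = x k ⊘ (y ^ᴷ suc (toℕ k))
    S = y ⊕ sumK n z

    bounded-x : ∀ k → BoundedDenominators (x k)
    bounded-x k = IsAlgInt⇒BoundedDenominators (alg k)

    trace-x∈ℤ : ∀ k → IsInteger (trace (x k))
    trace-x∈ℤ k = BoundedDenominators⇒integral-trace (bounded-x k)

    norm-x∈ℤ : ∀ k → IsInteger (norm (x k))
    norm-x∈ℤ k = BoundedDenominators⇒integral-norm (bounded-x k)

    bounded-w : BoundedDenominators w
    bounded-w = BoundedDenominators-prodK n λ k → IsAlgInt⇒BoundedDenominators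
      (integral-trace-norm⇒IsAlgInt (IsInteger-trace-3x+1 {x = x k} (trace-x∈ℤ k))
        (IsInteger-norm-3x+1 {x = x k} (trace-x∈ℤ k) (norm-x∈ℤ k)))

    re-y∈ℤ : IsInteger (re y)
    re-y∈ℤ = subst IsInteger
      (sym (solve 3 (λ a b D → con (+ 2 / 1) :* a :- D :* (con 0ℚ :* b) := a :+ a)
                    refl (re w) (im w) (δ {suc d′})))
      (BoundedDenominators⇒integral-trace bounded-w)

    im-y∈ℤ : IsInteger (im y)
    im-y∈ℤ = subst IsInteger
      (sym (solve 2 (λ a b → con (+ 2 / 1) :* b :+ con 0ℚ :* a := b :+ b) refl (re w) (im w)))
      (integral-trace-norm⇒integral-2im squarefree {w}
        (BoundedDenominators⇒integral-trace bounded-w) (BoundedDenominators⇒integral-norm bounded-w))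

    1≤norm-u : ∀ k → 1ℚ ≤ norm (u k)
    1≤norm-u k = 1≤norm-3x+1 {x = x k} (trace-x∈ℤ k) (norm-x∈ℤ k)

    norm-y≡4norm-w : norm y ≡ + 4 / 1 * norm w
    norm-y≡4norm-w = trans (norm-⊗ (ι (+ 2 / 1)) w) (cong (_* norm w) (norm-ι {suc d′} (+ 2 / 1)))

    norm-w≡product : norm w ≡ product (λ k → norm (u k))
    norm-w≡product = norm-prodK n u

    0≤4 : 0ℚ ≤ + 4 / 1
    0≤4 = /1-mono-≤ {+ 0} {+ 4} (ℤ.+≤+ ℕ.z≤n)

    9norm-x≤norm-y : ∀ k → + 9 / 1 * norm (x k) ≤ norm y
    9norm-x≤norm-y k = begin
      + 9 / 1 * norm (x k)  ≤⟨ 9norm≤4norm-3x+1 (x k) (1≤norm-u k) ⟩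
      + 4 / 1 * norm (u k)  ≤⟨ ℚP.*-monoˡ-≤-nonNeg (+ 4 / 1) {{nonNegative 0≤4}}
                                 (subst (norm (u k) ≤_) (sym norm-w≡product) (≤product _ 1≤norm-u k)) ⟩
      + 4 / 1 * norm w      ≡⟨ sym norm-y≡4norm-w ⟩
      norm y ∎
      where open ℚP.≤-Reasoning

    4≤norm-y : + 4 / 1 ≤ norm y
    4≤norm-y = subst₂ _≤_ (ℚP.*-identityʳ (+ 4 / 1)) (sym norm-y≡4norm-w)
      (ℚP.*-monoˡ-≤-nonNeg (+ 4 / 1) {{nonNegative 0≤4}}
        (subst (1ℚ ≤_) (sym norm-w≡product) (1≤product _ 1≤norm-u)))

    0<norm-y : 0ℚ < norm y
    0<norm-y = ℚP.<-≤-trans (toWitness {a? = 0ℚ ℚP.<? + 4 / 1} _) 4≤norm-y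

    norm-y≢0 : norm y ≢ 0ℚ
    norm-y≢0 norm-y≡0 = ℚP.<-irrefl (sym norm-y≡0) 0<norm-y

    ⅓ ⅑ ¼ I : ℚ
    ⅓ = + 1 / 3
    ⅑ = + 1 / 9
    ¼ = + 1 / 4
    I = invℚ {suc d′} (norm y)

    0≤⅑ : 0ℚ ≤ ⅑
    0≤⅑ = toWitness {a? = 0ℚ ℚP.≤? ⅑} _

    0≤I : 0ℚ ≤ I
    0≤I = 0≤invℚ {suc d′} (0≤norm y)

    *I≤1 : ∀ {p} → p ≤ norm y → p * I ≤ 1ℚ
    *I≤1 {p} p≤norm-y = subst (p * I ≤_) (invℚ-inverseʳ {suc d′} norm-y≢0)
      (ℚP.*-monoʳ-≤-nonNeg I {{nonNegative 0≤I}} p≤norm-y)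

    I≤¼ : I ≤ ¼
    I≤¼ = subst₂ _≤_ (solve 1 (λ I → con ¼ :* (con (+ 4 / 1) :* I) := I) refl I) (ℚP.*-identityʳ ¼)
      (ℚP.*-monoˡ-≤-nonNeg ¼ {{nonNegative (toWitness {a? = 0ℚ ℚP.≤? ¼} _)}} (*I≤1 4≤norm-y))

    norm-x*I≤⅑ : ∀ k → norm (x k) * I ≤ ⅑
    norm-x*I≤⅑ k = subst₂ _≤_
      (solve 2 (λ p I → con ⅑ :* (con (+ 9 / 1) :* p :* I) := p :* I) refl (norm (x k)) I)
      (ℚP.*-identityʳ ⅑)
      (ℚP.*-monoˡ-≤-nonNeg ⅑ {{nonNegative 0≤⅑}} (*I≤1 (9norm-x≤norm-y k)))

    norm-z : ∀ k → norm (z k) ≡ norm (x k) * I ^ suc (toℕ k)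
    norm-z k = trans (norm-⊗ (x k) (inv (y ^ᴷ j)))
      (cong (norm (x k) *_) (trans (norm-inv (y ^ᴷ j))
        (trans (cong (invℚ {suc d′}) (norm-^ᴷ y j)) (invℚ-^ {suc d′} (norm y) j))))
      where
      j : ℕ
      j = suc (toℕ k)

    ∣im-z∣≤ : ∀ k → ∣ im (z k) ∣ ≤ ⅓ * ½ ^ toℕ k
    ∣im-z∣≤ k = p*p≤r*r⇒∣p∣≤r (im (z k)) (⅓ * ½ ^ i)
      (0≤* (toWitness {a? = 0ℚ ℚP.≤? ⅓} _) (0≤^ i (toWitness {a? = 0ℚ ℚP.≤? ½} _))) (begin
        im (z k) * im (z k)       ≤⟨ im*im≤norm (z k) ⟩
        norm (z k)                ≡⟨ norm-z k ⟩
        norm (x k) * (I * I ^ i)  ≡⟨ sym (ℚP.*-assoc (norm (x k)) I (I ^ i)) ⟩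
        norm (x k) * I * I ^ i    ≤⟨ ℚP.*-monoʳ-≤-nonNeg (I ^ i) {{nonNegative (0≤^ i 0≤I)}}
                                       (norm-x*I≤⅑ k) ⟩
        ⅑ * I ^ i                 ≤⟨ ℚP.*-monoˡ-≤-nonNeg ⅑ {{nonNegative 0≤⅑}}
                                       (^-mono-≤ i 0≤I I≤¼) ⟩
        ⅑ * ¼ ^ i                 ≡⟨ cong (⅑ *_) (^-distrib-* ½ ½ i) ⟩
        ⅑ * (½ ^ i * ½ ^ i)       ≡⟨ solve 1 (λ p → con ⅑ :* (p :* p) := (con ⅓ :* p) :* (con ⅓ :* p))
                                           refl (½ ^ i) ⟩
        (⅓ * ½ ^ i) * (⅓ * ½ ^ i) ∎)
      where
      open ℚP.≤-Reasoning
      i : ℕ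
      i = toℕ k

  im-y≢0⇒¬InQ : im y ≢ 0ℚ → ¬ InQ S
  im-y≢0⇒¬InQ im-y≢0 S∈ℚ = <⇒≱ ∣im-y∣<1 (IsInteger-≢0⇒1≤∣∣ im-y∈ℤ im-y≢0)
    where
    open ℚP.≤-Reasoning
    im-y≡-∑im-z : im y ≡ - sum (λ k → im (z k))
    im-y≡-∑im-z = inverseˡ-unique (im y) _ (trans (cong (λ e → im y + e) (sym (im-sumK n z))) S∈ℚ)
    ∣im-y∣<1 : ∣ im y ∣ < 1ℚ
    ∣im-y∣<1 = begin-strict
      ∣ im y ∣                    ≡⟨ trans (cong ∣_∣ im-y≡-∑im-z) (ℚP.∣-p∣≡∣p∣ _) ⟩
      ∣ sum (λ k → im (z k)) ∣    <⟨ ∣sum∣<c+c (λ k → im (z k)) ⅓ (toWitness {a? = 0ℚ ℚP.<? ⅓} _)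
                                       ∣im-z∣≤ ⟩
      ⅓ + ⅓                       <⟨ toWitness {a? = ⅓ + ⅓ ℚP.<? 1ℚ} _ ⟩
      1ℚ ∎

  module _ (im-y≡0 : im y ≡ 0ℚ) (S∈ℚ : InQ S) where

    private
      Y h : ℚ
      Y = re y
      h = invℚ {suc d′} Y

      y≡ιY : y ≡ ι Y
      y≡ιY = K-≡ refl im-y≡0

      Y*Y≡norm-y : Y * Y ≡ norm y
      Y*Y≡norm-y = sym (trans (cong norm y≡ιY) (norm-ι {suc d′} Y))

      hY≡1 : h * Y ≡ 1ℚ
      hY≡1 = invℚ-inverseˡ {suc d′} {Y} λ Y≡0 →
        norm-y≢0 (trans (sym Y*Y≡norm-y) (cong (λ e → e * e) Y≡0))

      im-z : ∀ k → im (z k) ≡ im (x k) * h ^ suc (toℕ k)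
      im-z k = trans (cong (λ e → im (x k ⊗ inv e)) (trans (cong (_^ᴷ j) y≡ιY) (ι-^ Y j)))
        (trans (cong (λ e → im (x k ⊗ e)) (trans (inv-ι (Y ^ j)) (cong ι (invℚ-^ {suc d′} Y j))))
          (im-⊗-ι (x k) (h ^ j)))
        where
        j : ℕ
        j = suc (toℕ k)

      g : Fin n → ℚ
      g k = im (x k) + im (x k)

      g∈ℤ : ∀ k → IsInteger (g k)
      g∈ℤ k = integral-trace-norm⇒integral-2im squarefree {x k} (trace-x∈ℤ k) (norm-x∈ℤ k)

      expansion≡0 : expansion h g ≡ 0ℚ
      expansion≡0 = begin
        sum (λ k → g k * h ^ suc (toℕ k))
          ≡⟨ sum-cong-≗ (λ k → trans (solve 2 (λ b p → (b :+ b) :* p := con (+ 2 / 1) :* (b :* p))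
                                               refl (im (x k)) _)
                                     (cong (+ 2 / 1 *_) (sym (im-z k)))) ⟩
        sum (λ k → + 2 / 1 * im (z k))    ≡⟨ sym (*-distribˡ-sum (+ 2 / 1) (λ k → im (z k))) ⟩
        + 2 / 1 * sum (λ k → im (z k))    ≡⟨ cong (+ 2 / 1 *_) ∑im-z≡0 ⟩
        + 2 / 1 * 0ℚ                      ≡⟨ ℚP.*-zeroʳ (+ 2 / 1) ⟩
        0ℚ ∎
        where
        open ≡-Reasoning
        ∑im-z≡0 : sum (λ k → im (z k)) ≡ 0ℚ
        ∑im-z≡0 = trans (sym (im-sumK n z))
          (trans (sym (ℚP.+-identityˡ _)) (trans (cong (_+ im (sumK n z)) (sym im-y≡0)) S∈ℚ))

      g²<Y² : ∀ k → g k * g k < Y * Y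
      g²<Y² k = ℚP.*-cancelˡ-<-nonNeg (+ 9 / 1) (begin-strict
        + 9 / 1 * (g k * g k)
          ≡⟨ solve 1 (λ b → con (+ 9 / 1) :* ((b :+ b) :* (b :+ b))
                         := con (+ 4 / 1) :* (con (+ 9 / 1) :* (b :* b))) refl (im (x k)) ⟩
        + 4 / 1 * (+ 9 / 1 * (im (x k) * im (x k)))
          ≤⟨ ℚP.*-monoˡ-≤-nonNeg (+ 4 / 1) {{nonNegative 0≤4}}
               (ℚP.≤-trans (ℚP.*-monoˡ-≤-nonNeg (+ 9 / 1) (im*im≤norm (x k))) (9norm-x≤norm-y k)) ⟩
        + 4 / 1 * norm y
          <⟨ ℚP.*-monoˡ-<-pos (norm y) {{positive 0<norm-y}} (toWitness {a? = + 4 / 1 ℚP.<? + 9 / 1} _) ⟩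
        + 9 / 1 * norm y
          ≡⟨ cong (+ 9 / 1 *_) (sym Y*Y≡norm-y) ⟩
        + 9 / 1 * (Y * Y) ∎)
        where open ℚP.≤-Reasoning

      g-small : ∀ k → ∣ g k ∣ + 1ℚ ≤ ∣ Y ∣
      g-small k = IsInteger-<⇒+1≤ (IsInteger-∣∣ (g∈ℤ k)) (IsInteger-∣∣ re-y∈ℤ)
        (p*p<q*q⇒∣p∣<∣q∣ (g k) Y (g²<Y² k))

      im-x≡0 : ∀ k → im (x k) ≡ 0ℚ
      im-x≡0 k = trans (solve 1 (λ b → b := (b :+ b) :* con ½) refl (im (x k)))
        (trans (cong (_* ½) (expansion≡0⇒digits≡0 {Y} {h} hY≡1 g g∈ℤ g-small expansion≡0 k))
               (ℚP.*-zeroˡ ½))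

    im-y≡0⇒integral : ∀ k → InZ (x k)
    im-y≡0⇒integral k = proj₁ re-x∈ℤ , K-≡ (proj₂ re-x∈ℤ) (im-x≡0 k)
      where
      re-x∈ℤ : IsInteger (re (x k))
      re-x∈ℤ = BoundedDenominators-ι⇒IsInteger
        (subst BoundedDenominators (K-≡ refl (im-x≡0 k)) (bounded-x k))

  InQ⇒integral : InQ S → ∀ k → InZ (x k)
  InQ⇒integral S∈ℚ = by-cases (im y ℚP.≟ 0ℚ)
    where
    by-cases : Dec (im y ≡ 0ℚ) → ∀ k → InZ (x k)
    by-cases (yes im-y≡0) = im-y≡0⇒integral im-y≡0 S∈ℚ
    by-cases (no im-y≢0) = contradiction S∈ℚ (im-y≢0⇒¬InQ im-y≢0)

  integral⇒InQ : (∀ k → InZ (x k)) → InQ S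
  integral⇒InQ x∈ℤ = InQ-⊕ {x = y} {y = sumK n z} y∈ℚ (InQ-sumK n λ k →
      InQ-⊗ {x = x k} (x∈ℚ k) (InQ-inv {x = y ^ᴷ suc (toℕ k)} (InQ-^ᴷ {x = y} (suc (toℕ k)) y∈ℚ)))
    where
    x∈ℚ : ∀ k → InQ (x k)
    x∈ℚ k = cong im (proj₂ (x∈ℤ k))
    u∈ℚ : ∀ k → InQ (u k)
    u∈ℚ k = InQ-⊕ {x = ι (+ 3 / 1) ⊗ x k} {y = ι (+ 1 / 1)}
      (InQ-⊗ {x = ι (+ 3 / 1)} {y = x k} refl (x∈ℚ k)) refl
    y∈ℚ : InQ y
    y∈ℚ = InQ-⊗ {x = ι (+ 2 / 1)} {y = w} refl (InQ-prodK n u∈ℚ)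

theorem1p2 : (d : ℕ) → d > 0 → SquareFree d →
    (n : ℕ) → n > 0 → (x : Fin n → K d) → (∀ k → IsAlgInt (x k)) →
    let y = ι (+ 2 / 1) ⊗ prodK n (λ k → ι (+ 3 / 1) ⊗ x k ⊕ ι (+ 1 / 1)) in
    InQ (y ⊕ sumK n (λ k → x k ⊘ (y ^ᴷ suc (toℕ k)))) ⇔ (∀ k → InZ (x k))
theorem1p2 (suc d′) _ squarefree n _ x alg =
  mk⇔ (InQ⇒integral squarefree x alg) (integral⇒InQ squarefree x alg)
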